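{- Let $G_1$ and $G_2$ be connected discrete graphs and let $\pi\colon G_1\to G_2$ be a harmonic morphism with degree assignment $d_\pi$. Let $e\in E(G_2)$ be an edge, with $\partial e=\{A,B\}$, such that the subgraph $\pi^{ -1}(e)$ of $G_1$ (consisting of the edges of $G_1$ mapped to $e$ together with their incident vertices) is a forest, with connected components $T_1,\dots,T_m$. Let $G_1/\pi^{ -1}(e)$ be the graph obtained from $G_1$ by contracting every edge of every $T_i$, so that each $T_i$ is collapsed to a single new vertex $V_{T_i}$, and let $p\colon G_2\to G_2/e$ be the contraction of the edge $e$, with new vertex $V_e$. Define $$\pi_e\colon F(G_1/\pi^{ -1}(e))\to F(G_2/e),\qquad H\mapsto \begin{cases} p(\pi(H)), & H\neq V_{T_i}\text{ for all } i,\\ V_e, & H=V_{T_i},\end{cases}$$ and $$d_e\colon F(G_1/\pi^{ -1}(e))\to \mathbb{Z}_{\geq 0},\qquad H\mapsto\begin{cases} d_\pi(H), & H\neq V_{T_i}\text{ for all } i,\\ \sum_{h\in E(T_i)} d_\pi(h), & H=V_{T_i}.\end{cases}$$ Then $\pi_e$ together with the degree assignment $d_e$ is a harmonic morphism $G_1/\pi^{ -1}(e)\to G_2/e$, and for every $1\leq i\leq m$, $$r_{\pi_e}(V_{T_i})=\sum_{V\in V(T_i)} r_\pi(V).$$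
   Context: A discrete graph $G$ is a triple $(F(G),r_G,\iota_G)$ with $F(G)$ a finite set (of flags), $r_G\colon F(G)\to F(G)$ a map (root map) and $\iota_G$ an involution of $F(G)$ with $\iota_G\circ r_G=r_G$. The vertices are $V(G)=\operatorname{Im}(r_G)$; the remaining flags $H(G)$ are half-edges; size-one $\iota_G$-orbits in $H(G)$ are legs, size-two orbits are edges; the boundary $\partial e$ of an edge $e$ is $r_G(e)$. The valency of $V\in V(G)$ is $\operatorname{val}(V)=\#r_G^{ -1}(V)-1$. Connectedness, subgraphs, genus $g(G)=\#E(G)-\#V(G)+1$, trees and forests are as usual. Contracting an edge $e$ of $G$ means identifying the subset $e\cup\partial e\subset F(G)$ to a single new vertex $V_e$, with root and involution maps induced from those of $G$ (and $V_e$ fixed by both); contracting a legless subgraph means successively contracting all its edges, each connected component becoming one new vertex. A map of graphs $f\colon G_1\to G_2$ is a map $F(G_1)\to F(G_2)$ commuting with the root maps and the involutions; it is non-contracting if $f^{ -1}(V(G_2))\subseteq V(G_1)$. A degree assignment on $G_1$ is a map $d\colon F(G_1)\to\mathbb{Z}_{\geq0}$ with $d\circ\iota_{G_1}=d$ (so edges and legs have well-defined degrees). A harmonic morphism $\pi\colon G_1\to G_2$ is a surjective non-contracting map of graphs together with a degree assignment $d_\pi$ on $G_1$ such that for every $V\in V(G_1)$ and every $H'\in r_{G_2}^{ -1}(\pi(V))\setminus\{\pi(V)\}$ one has $d_\pi(V)=\sum_{H\in\pi^{ -1}(H')\cap r_{G_1}^{ -1}(V)} d_\pi(H)$. The Riemann–Hurwitz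 number of $\pi$ at $V\in V(G_1)$ is $r_\pi(V)=\operatorname{val}(V)-2-d_\pi(V)\,(\operatorname{val}(\pi(V))-2)$. -}

module Defs where

open import Data.Nat using (ℕ; zero; suc; _+_; _<ᵇ_)
open import Data.Integer as ℤ using (ℤ; +_)
open import Data.Fin using (Fin; toℕ; _≟_)
open import Data.Bool using (Bool; true; false; if_then_else_; _∧_; _∨_; not; T)
open import Data.List using (List; allFin; foldr)
open import Data.Product using (∃; _×_)
open import Data.Sum using (_⊎_)
open import Relation.Nullary using (¬_)
open import Relation.Binary.PropositionalEquality using (_≡_)
open import Relation.Nullary.Decidable using (⌊_⌋)
open import Relation.Binary.Construct.Closure.ReflexiveTransitive using (Star)
open import Function.Bundles using (_⇔_)

-- Discrete graphs: flags are Fin nF; root map r (a retraction, r ∘ r = r),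
-- involution ι with ι ∘ r = r.

record Graph : Set where
  field
    nF      : ℕ
    r       : Fin nF → Fin nF
    ι       : Fin nF → Fin nF
    r-idem  : ∀ x → r (r x) ≡ r x
    ι-invol : ∀ x → ι (ι x) ≡ x
    ι-r     : ∀ x → ι (r x) ≡ r x

F : Graph → Set
F G = Fin (Graph.nF G)

rt : (G : Graph) → F G → F G
rt = Graph.r

iv : (G : Graph) → F G → F G
iv = Graph.ι

_==_ : ∀ {n} → Fin n → Fin n → Bool
x == y = ⌊ x ≟ y ⌋

sumℕ : ∀ {n} → (Fin n → Bool) → (Fin n → ℕ) → ℕ
sumℕ {n} P f = foldr (λ x acc → if P x then f x + acc else acc) 0 (allFin n)

sumℤ : ∀ {n} → (Fin n → Bool) → (Fin n → ℤ) → ℤ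
sumℤ {n} P f = foldr (λ x acc → if P x then f x ℤ.+ acc else acc) (+ 0) (allFin n)

count : ∀ {n} → (Fin n → Bool) → ℕ
count P = sumℕ P (λ _ → 1)

anyF : ∀ {n} → (Fin n → Bool) → Bool
anyF {n} P = foldr (λ x b → P x ∨ b) false (allFin n)

-- vertices = image of r = fixed points of r (r is a retraction)
IsVertex : (G : Graph) → F G → Set
IsVertex G x = rt G x ≡ x

isV : (G : Graph) → F G → Bool
isV G x = rt G x == x

-- a chosen representative half-edge of each edge {h, ι h} (h ≠ ι h)
isEdgeRep : (G : Graph) → F G → Bool
isEdgeRep G h = not (isV G h) ∧ (toℕ h <ᵇ toℕ (iv G h))

numEdgesIn : (G : Graph) → (F G → Bool) → ℕ
numEdgesIn G P = count (λ h → isEdgeRep G h ∧ P h)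

numVertsIn : (G : Graph) → (F G → Bool) → ℕ
numVertsIn G P = count (λ x → isV G x ∧ P x)

Adj : (G : Graph) → F G → F G → Set
Adj G x y = (y ≡ rt G x) ⊎ (y ≡ iv G x) ⊎ (x ≡ rt G y) ⊎ (x ≡ iv G y)

Connected : Graph → Set
Connected G = ∀ x y → Star (Adj G) x y

AdjIn : (G : Graph) → (F G → Bool) → F G → F G → Set
AdjIn G S x y = T (S x) × T (S y) × Adj G x y

SameComp : (G : Graph) → (F G → Bool) → F G → F G → Set
SameComp G S = Star (AdjIn G S)

-- G' (with quotient map c) is the graph obtained from G by contracting the
-- legless subgraph S: F(G') = F(G)/~ where ~ identifies all flags of each
-- connected component of S, root and involution induced.
record IsContraction (G : Graph) (S : F G → Bool) (G' : Graph)
                     (c : F G → F G') : Set where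
  field
    surj   : ∀ y → ∃ λ x → c x ≡ y
    ident  : ∀ x y → (c x ≡ c y) ⇔ (x ≡ y ⊎ (T (S x) × T (S y) × SameComp G S x y))
    root   : ∀ x → c (rt G x) ≡ rt G' (c x)
    invol  : ∀ x → c (iv G x) ≡ iv G' (c x)

record IsHarmonic (G₁ G₂ : Graph) (f : F G₁ → F G₂) (d : F G₁ → ℕ) : Set where
  field
    comm-r   : ∀ x → f (rt G₁ x) ≡ rt G₂ (f x)
    comm-ι   : ∀ x → f (iv G₁ x) ≡ iv G₂ (f x)
    surj     : ∀ y → ∃ λ x → f x ≡ y
    noncontr : ∀ x → IsVertex G₂ (f x) → IsVertex G₁ x
    deg-ι    : ∀ x → d (iv G₁ x) ≡ d x
    harmonic : ∀ V → IsVertex G₁ V → ∀ H' → rt G₂ H' ≡ f V → ¬ (H' ≡ f V) →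
               d V ≡ sumℕ (λ H → (f H == H') ∧ (rt G₁ H == V)) d

val : (G : Graph) → F G → ℤ
val G V = + count (λ H → rt G H == V) ℤ.- + 1

RH : (G₁ G₂ : Graph) → (F G₁ → F G₂) → (F G₁ → ℕ) → F G₁ → ℤ
RH G₁ G₂ f d V = val G₁ V ℤ.- + 2 ℤ.- (+ d V) ℤ.* (val G₂ (f V) ℤ.- + 2)

-- the subgraph π⁻¹(e): half-edges over the edge {e, ι e} and their roots
preHalf : (G₁ G₂ : Graph) → (F G₁ → F G₂) → F G₂ → F G₁ → Bool
preHalf G₁ G₂ π e h = not (isV G₁ h) ∧ ((π h == e) ∨ (π h == iv G₂ e))

preimS : (G₁ G₂ : Graph) → (F G₁ → F G₂) → F G₂ → F G₁ → Bool
preimS G₁ G₂ π e x =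
  preHalf G₁ G₂ π e x ∨ anyF (λ h → preHalf G₁ G₂ π e h ∧ (rt G₁ h == x))

edgeS : (G : Graph) → F G → F G → Bool
edgeS G e x = (x == e) ∨ (x == iv G e) ∨ (x == rt G e) ∨ (x == rt G (iv G e))

{-# OPTIONS --safe #-}
module Submission where

-- Since c₁ is injective off S = π⁻¹(e) and πₑ ∘ c₁ = p ∘ π, the morphism axioms of πₑ
-- descend from those of π. Harmonicity at a vertex outside S is inherited from π (a vertex outside S
-- lying over an endpoint of e has degree 0). At a contracted tree V_T one sums the harmonicity of π
-- over the vertices of T above an endpoint of e: every edge of T has exactly one half over e, so the
-- sum is d_e(V_T). For the Riemann–Hurwitz number, T has one vertex more than edges, which gives
-- Σ_{V ∈ T} (val V − 2) = val V_T − 2, and val V_e − 2 = (val A − 2) + (val B − 2) when A ≠ B.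
-- When e is a loop (A = B) this last identity fails, but then d vanishes on T: a vertex of positive
-- degree has positive halves over both e and ι e, and together with connectedness of T this would
-- give T at least as many edges as vertices.

open import Defs
open import Algebra.Bundles using (CommutativeMonoid)
open import Data.Bool using (Bool; true; false; if_then_else_; _∧_; _∨_; not; T)
open import Data.Bool.Properties using (∧-identityʳ)
open import Data.Empty using (⊥-elim)
open import Data.Fin using (Fin; zero; suc; toℕ; punchIn; _≟_)
open import Data.Fin.Properties using (punchInᵢ≢i; ¬∀⟶∃¬; toℕ-injective)
open import Data.Integer as ℤ using (ℤ; +_; _⊖_)
import Data.Integer.Properties as ZP
open import Data.Integer.Tactic.RingSolver using (solve-∀)
open import Data.List using ([]; _∷_; foldr; allFin; tabulate)
open import Data.List.Membership.Propositional using (_∈_)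
open import Data.List.Membership.Propositional.Properties using (∈-allFin)
open import Data.List.Relation.Unary.Any using (here; there)
open import Data.Nat as ℕ using (ℕ; zero; suc; _+_; _*_; _≤_; z≤n; s≤s)
import Data.Nat.Properties as NP
import Data.Nat.Tactic.RingSolver as ℕSolver
open import Data.Product using (∃; _×_; _,_; proj₁; proj₂)
open import Data.Sum using (_⊎_; inj₁; inj₂; [_,_]′)
open import Data.Unit using (tt)
open import Function using (_∘_)
open import Function.Bundles using (Equivalence; _⇔_)
open import Relation.Binary.Construct.Closure.ReflexiveTransitive as Star using (Star; _◅_)
open import Relation.Binary.Definitions using (tri<; tri≈; tri>)
open import Relation.Binary.PropositionalEquality as ≡ using (_≡_)
open import Relation.Nullary using (¬_; Dec; yes; no)
open import Relation.Nullary.Decidable using (T?; _→-dec_; toWitness; fromWitness)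

∧-intro : ∀ {a b} → T a → T b → T (a ∧ b)
∧-intro {true} {true} _ _ = tt

∧-fst : ∀ {a b} → T (a ∧ b) → T a
∧-fst {true} _ = tt

∧-snd : ∀ {a b} → T (a ∧ b) → T b
∧-snd {true} q = q

∨-inl : ∀ {a b} → T a → T (a ∨ b)
∨-inl {true} _ = tt

∨-inr : ∀ {a b} → T b → T (a ∨ b)
∨-inr {true}  _ = tt
∨-inr {false} q = q

∨-case : ∀ {a b} → T (a ∨ b) → T a ⊎ T b
∨-case {true}  _ = inj₁ tt
∨-case {false} q = inj₂ q

not-intro : ∀ {a} → ¬ T a → T (not a)
not-intro {true}  ¬a = ¬a tt
not-intro {false} _  = tt

not-elim : ∀ {a} → T (not a) → ¬ T a
not-elim {true} ()

T-or-not : ∀ b → T b ⊎ T (not b)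
T-or-not true  = inj₁ tt
T-or-not false = inj₂ tt

T-ext : ∀ {a b} → (T a → T b) → (T b → T a) → a ≡ b
T-ext {true}  {true}  _ _ = ≡.refl
T-ext {true}  {false} f _ = ⊥-elim (f tt)
T-ext {false} {true}  _ g = ⊥-elim (g tt)
T-ext {false} {false} _ _ = ≡.refl

==⇒≡ : ∀ {n} {x y : Fin n} → T (x == y) → x ≡ y
==⇒≡ = toWitness

≡⇒== : ∀ {n} {x y : Fin n} → x ≡ y → T (x == y)
≡⇒== = fromWitness

==-refl : ∀ {n} (x : Fin n) → T (x == x)
==-refl x = ≡⇒== ≡.refl

module RestrictedSum {c ℓ} (M : CommutativeMonoid c ℓ) where

  open CommutativeMonoid M
  open import Algebra.Properties.CommutativeMonoid.Sum M
    using (sum; sum-cong-≋; sum-replicate-zero; sum-remove; ∑-distrib-+; ∑-comm)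
  open import Relation.Binary.Reasoning.Setoid setoid

  private variable n k : ℕ

  sumWhere : (Fin n → Bool) → (Fin n → Carrier) → Carrier
  sumWhere {n} P f = foldr (λ x acc → if P x then f x ∙ acc else acc) ε (allFin n)

  restrict : (Fin n → Bool) → (Fin n → Carrier) → Fin n → Carrier
  restrict P f x = if P x then f x else ε

  restrict-T : ∀ (P : Fin n → Bool) f {x} → T (P x) → restrict P f x ≡ f x
  restrict-T P f {x} px with P x
  ... | true = ≡.refl

  restrict-¬T : ∀ (P : Fin n → Bool) f {x} → ¬ T (P x) → restrict P f x ≡ ε
  restrict-¬T P f {x} ¬px with P x
  ... | true  = ⊥-elim (¬px _)
  ... | false = ≡.refl

  private
    foldr-tabulate : ∀ (g : Fin n → Fin k) P f →
      foldr (λ x acc → if P x then f x ∙ acc else acc) ε (tabulate g) ≈ sum (restrict P f ∘ g)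
    foldr-tabulate {ℕ.zero}  g P f = refl
    foldr-tabulate {ℕ.suc n} g P f with P (g zero)
    ... | true  = ∙-cong refl (foldr-tabulate (g ∘ suc) P f)
    ... | false = trans (foldr-tabulate (g ∘ suc) P f) (sym (identityˡ _))

  sumWhere≈sum : ∀ (P : Fin n → Bool) f → sumWhere P f ≈ sum (restrict P f)
  sumWhere≈sum P f = foldr-tabulate (λ x → x) P f

  sum-zero : ∀ {w : Fin n → Carrier} → (∀ x → w x ≈ ε) → sum w ≈ ε
  sum-zero {n} w≈0 = trans (sum-cong-≋ w≈0) (sum-replicate-zero n)

  sum-single : ∀ {w : Fin n → Carrier} x₀ → (∀ x → ¬ x ≡ x₀ → w x ≈ ε) → sum w ≈ w x₀
  sum-single {ℕ.suc n} {w} x₀ w≈0 = begin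
    sum w                                  ≈⟨ sum-remove {i = x₀} w ⟩
    w x₀ ∙ sum (λ j → w (punchIn x₀ j))    ≈⟨ ∙-cong refl (sum-zero (λ j → w≈0 (punchIn x₀ j) (punchInᵢ≢i x₀ j))) ⟩
    w x₀ ∙ ε                               ≈⟨ identityʳ _ ⟩
    w x₀                                   ∎

  sumWhere-cong : ∀ {P Q : Fin n → Bool} {f g} → (∀ x → P x ≡ Q x) → (∀ x → T (P x) → f x ≈ g x) →
                  sumWhere P f ≈ sumWhere Q g
  sumWhere-cong {P = P} {Q} {f} {g} P≡Q f≈g = begin
    sumWhere P f          ≈⟨ sumWhere≈sum P f ⟩
    sum (restrict P f)    ≈⟨ sum-cong-≋ pointwise ⟩
    sum (restrict Q g)    ≈⟨ sumWhere≈sum Q g ⟨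
    sumWhere Q g          ∎
    where
    pointwise : ∀ x → restrict P f x ≈ restrict Q g x
    pointwise x with P x | Q x | P≡Q x | f≈g x
    ... | true  | .true  | ≡.refl | f≈gₓ = f≈gₓ tt
    ... | false | .false | ≡.refl | _    = refl

  sumWhere-congᴾ : ∀ {P Q : Fin n → Bool} {f} → (∀ x → T (P x) → T (Q x)) → (∀ x → T (Q x) → T (P x)) →
                   sumWhere P f ≈ sumWhere Q f
  sumWhere-congᴾ P⇒Q Q⇒P = sumWhere-cong (λ x → T-ext (P⇒Q x) (Q⇒P x)) (λ _ _ → refl)

  sumWhere-congᶠ : ∀ {P : Fin n → Bool} {f g} → (∀ x → T (P x) → f x ≈ g x) → sumWhere P f ≈ sumWhere P g
  sumWhere-congᶠ = sumWhere-cong (λ _ → ≡.refl)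

  sumWhere-zero : ∀ {P : Fin n → Bool} {f} → (∀ x → T (P x) → f x ≈ ε) → sumWhere P f ≈ ε
  sumWhere-zero {P = P} {f} f≈0 = trans (sumWhere≈sum P f) (sum-zero pointwise)
    where
    pointwise : ∀ x → restrict P f x ≈ ε
    pointwise x with P x | f≈0 x
    ... | true  | f≈0ₓ = f≈0ₓ tt
    ... | false | _    = refl

  sumWhere-empty : ∀ {P : Fin n → Bool} {f} → (∀ x → ¬ T (P x)) → sumWhere P f ≈ ε
  sumWhere-empty ¬P = sumWhere-zero (λ x px → ⊥-elim (¬P x px))

  sumWhere-single : ∀ {P : Fin n → Bool} {f} x₀ → T (P x₀) → (∀ x → T (P x) → x ≡ x₀) → sumWhere P f ≈ f x₀
  sumWhere-single {P = P} {f} x₀ px₀ unique = begin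
    sumWhere P f          ≈⟨ sumWhere≈sum P f ⟩
    sum (restrict P f)    ≈⟨ sum-single x₀ outside ⟩
    restrict P f x₀       ≡⟨ restrict-T P f px₀ ⟩
    f x₀                  ∎
    where
    outside : ∀ x → ¬ x ≡ x₀ → restrict P f x ≈ ε
    outside x x≢x₀ = reflexive (restrict-¬T P f (x≢x₀ ∘ unique x))

  sumWhere-split : ∀ (P Q : Fin n → Bool) f →
                   sumWhere P f ≈ sumWhere (λ x → P x ∧ Q x) f ∙ sumWhere (λ x → P x ∧ not (Q x)) f
  sumWhere-split P Q f = begin
    sumWhere P f                                      ≈⟨ sumWhere≈sum P f ⟩
    sum (restrict P f)                                ≈⟨ sum-cong-≋ pointwise ⟩
    sum (λ x → restrict P∧Q f x ∙ restrict P∧¬Q f x)  ≈⟨ ∑-distrib-+ (restrict P∧Q f) (restrict P∧¬Q f) ⟩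
    sum (restrict P∧Q f) ∙ sum (restrict P∧¬Q f)      ≈⟨ ∙-cong (sumWhere≈sum P∧Q f) (sumWhere≈sum P∧¬Q f) ⟨
    sumWhere P∧Q f ∙ sumWhere P∧¬Q f                  ∎
    where
    P∧Q P∧¬Q : Fin _ → Bool
    P∧Q x = P x ∧ Q x
    P∧¬Q x = P x ∧ not (Q x)
    pointwise : ∀ x → restrict P f x ≈ restrict P∧Q f x ∙ restrict P∧¬Q f x
    pointwise x with P x | Q x
    ... | true  | true  = sym (identityʳ _)
    ... | true  | false = sym (identityˡ _)
    ... | false | _     = sym (identityˡ _)

  sumWhere-fibres : ∀ (P : Fin n → Bool) f (g : Fin n → Fin k) (Q : Fin k → Bool) →
                    (∀ x → T (P x) → T (Q (g x))) →
                    sumWhere P f ≈ sumWhere Q (λ y → sumWhere (λ x → P x ∧ (g x == y)) f)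
  sumWhere-fibres {n} {k} P f g Q P⇒Qg = begin
    sumWhere P f                        ≈⟨ sumWhere≈sum P f ⟩
    sum (restrict P f)                  ≈⟨ sum-cong-≋ (λ x → sym (on-fibre x)) ⟩
    sum (λ x → sum (λ y → entry x y))  ≈⟨ ∑-comm entry ⟩
    sum (λ y → sum (λ x → entry x y))  ≈⟨ sum-cong-≋ fibre ⟩
    sum (restrict Q fibreSum)           ≈⟨ sumWhere≈sum Q fibreSum ⟨
    sumWhere Q fibreSum                 ∎
    where
    Fibre : Fin k → Fin n → Bool
    Fibre y x = P x ∧ (g x == y)
    fibreSum : Fin k → Carrier
    fibreSum y = sumWhere (Fibre y) f
    entry : Fin n → Fin k → Carrier
    entry x y = restrict (Fibre y) f x
    on-fibre : ∀ x → sum (entry x) ≈ restrict P f x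
    on-fibre x with T-or-not (P x)
    ... | inj₁ px  = begin
      sum (entry x)    ≈⟨ sum-single (g x) (λ y y≢gx → reflexive (restrict-¬T (Fibre y) f
                            (λ q → y≢gx (≡.sym (==⇒≡ (∧-snd {P x} q)))))) ⟩
      entry x (g x)    ≡⟨ restrict-T (Fibre (g x)) f (∧-intro px (==-refl (g x))) ⟩
      f x              ≡⟨ restrict-T P f px ⟨
      restrict P f x   ∎
    ... | inj₂ ¬px = begin
      sum (entry x)    ≈⟨ sum-zero (λ y → reflexive (restrict-¬T (Fibre y) f (not-elim ¬px ∘ ∧-fst))) ⟩
      ε                ≡⟨ restrict-¬T P f (not-elim ¬px) ⟨
      restrict P f x   ∎
    fibre : ∀ y → sum (λ x → entry x y) ≈ restrict Q fibreSum y
    fibre y with Q y in Qy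
    ... | true  = sym (sumWhere≈sum (Fibre y) f)
    ... | false = sum-zero (λ x → reflexive (restrict-¬T (Fibre y) f (λ q →
                    ≡.subst T Qy (≡.subst (T ∘ Q) (==⇒≡ (∧-snd {P x} q)) (P⇒Qg x (∧-fst q))))))

  sumWhere-reindex : ∀ (c : Fin n → Fin k) (P : Fin n → Bool) (Q : Fin k → Bool) f →
                     (∀ x → T (P x) → T (Q (c x))) →
                     (∀ x y → T (P x) → T (P y) → c x ≡ c y → x ≡ y) →
                     (∀ y → T (Q y) → ∃ λ x → T (P x) × c x ≡ y) →
                     sumWhere Q f ≈ sumWhere P (f ∘ c)
  sumWhere-reindex c P Q f P⇒Qc injective onto = sym (begin
    sumWhere P (f ∘ c)                                             ≈⟨ sumWhere-fibres P (f ∘ c) c Q P⇒Qc ⟩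
    sumWhere Q (λ y → sumWhere (λ x → P x ∧ (c x == y)) (f ∘ c))  ≈⟨ sumWhere-congᶠ singleton-fibre ⟩
    sumWhere Q f                                                   ∎)
    where
    singleton-fibre : ∀ y → T (Q y) → sumWhere (λ x → P x ∧ (c x == y)) (f ∘ c) ≈ f y
    singleton-fibre y qy with onto y qy
    ... | x₀ , px₀ , cx₀≡y = trans
      (sumWhere-single x₀ (∧-intro px₀ (≡⇒== cx₀≡y))
        (λ x q → injective x x₀ (∧-fst q) px₀ (≡.trans (==⇒≡ (∧-snd {P x} q)) (≡.sym cx₀≡y))))
      (reflexive (≡.cong f cx₀≡y))

  module _ (ι : Fin n → Fin n) (ι-invol : ∀ x → ι (ι x) ≡ x)
           {f : Fin n → Carrier} (f∘ι≈f : ∀ x → f (ι x) ≈ f x) where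

    sumWhere-transversal : ∀ {Q Q′ : Fin n → Bool} →
      (∀ x → T (Q x) → T (Q′ x) ⊎ T (Q′ (ι x))) → (∀ x → T (Q′ x) → T (Q x) ⊎ T (Q (ι x))) →
      (∀ x → T (Q x) → ¬ T (Q (ι x))) → (∀ x → T (Q′ x) → ¬ T (Q′ (ι x))) →
      sumWhere Q f ≈ sumWhere Q′ f
    sumWhere-transversal {Q} {Q′} Q⇒Q′ Q′⇒Q Q-once Q′-once =
      trans (sumWhere-reindex choose Q′ Q f choose-Q′ injective onto) (sumWhere-congᶠ choose-invariant)
      where
      choose : Fin n → Fin n
      choose x = if Q x then x else ι x
      chosen : ∀ x → T (Q′ x) → (T (Q x) × choose x ≡ x) ⊎ (T (Q (ι x)) × choose x ≡ ι x)
      chosen x q′ with Q x | Q′⇒Q x q′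
      ... | true  | _         = inj₁ (tt , ≡.refl)
      ... | false | inj₂ q-ιx = inj₂ (q-ιx , ≡.refl)
      choose-Q′ : ∀ x → T (Q′ x) → T (Q (choose x))
      choose-Q′ x q′ with chosen x q′
      ... | inj₁ (qx , eq)   = ≡.subst (T ∘ Q) (≡.sym eq) qx
      ... | inj₂ (q-ιx , eq) = ≡.subst (T ∘ Q) (≡.sym eq) q-ιx
      choose-invariant : ∀ x → T (Q′ x) → f (choose x) ≈ f x
      choose-invariant x q′ with chosen x q′
      ... | inj₁ (_ , eq) = reflexive (≡.cong f eq)
      ... | inj₂ (_ , eq) = trans (reflexive (≡.cong f eq)) (f∘ι≈f x)
      injective : ∀ x y → T (Q′ x) → T (Q′ y) → choose x ≡ choose y → x ≡ y
      injective x y q′x q′y eq with chosen x q′x | chosen y q′y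
      ... | inj₁ (_ , ex) | inj₁ (_ , ey) = ≡.trans (≡.sym ex) (≡.trans eq ey)
      ... | inj₂ (_ , ex) | inj₂ (_ , ey) =
        ≡.trans (≡.sym (ι-invol x)) (≡.trans (≡.cong ι (≡.trans (≡.sym ex) (≡.trans eq ey))) (ι-invol y))
      ... | inj₁ (_ , ex) | inj₂ (_ , ey) = ⊥-elim (Q′-once y q′y (≡.subst (T ∘ Q′) x≡ιy q′x))
        where
        x≡ιy : x ≡ ι y
        x≡ιy = ≡.trans (≡.sym ex) (≡.trans eq ey)
      ... | inj₂ (_ , ex) | inj₁ (_ , ey) = ⊥-elim (Q′-once x q′x (≡.subst (T ∘ Q′) y≡ιx q′y))
        where
        y≡ιx : y ≡ ι x
        y≡ιx = ≡.trans (≡.sym ey) (≡.trans (≡.sym eq) ex)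
      onto : ∀ y → T (Q y) → ∃ λ x → T (Q′ x) × choose x ≡ y
      onto y qy with Q⇒Q′ y qy
      ... | inj₁ q′y = y , q′y , chosen-self
        where
        chosen-self : choose y ≡ y
        chosen-self with Q y
        ... | true = ≡.refl
      ... | inj₂ q′ιy = ι y , q′ιy , chosen-partner
        where
        chosen-partner : choose (ι y) ≡ y
        chosen-partner with Q (ι y) in Qιy
        ... | true  = ⊥-elim (Q-once y qy (≡.subst T (≡.sym Qιy) tt))
        ... | false = ι-invol y

    sumWhere-pairs : ∀ {P Q : Fin n → Bool} → (∀ x → T (P x) → T (Q x) ⊎ T (Q (ι x))) →
      (∀ x → T (Q x) → T (P x)) → (∀ x → T (P x) → T (P (ι x))) → (∀ x → T (Q x) → ¬ T (Q (ι x))) →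
      sumWhere P f ≈ sumWhere Q f ∙ sumWhere Q f
    sumWhere-pairs {P} {Q} P⇒Q Q⇒P P-ι Q-once = begin
      sumWhere P f                                              ≈⟨ sumWhere-split P Q f ⟩
      sumWhere (λ x → P x ∧ Q x) f ∙ sumWhere (λ x → P x ∧ not (Q x)) f
        ≈⟨ ∙-cong (sumWhere-congᴾ (λ x → ∧-snd {P x}) (λ x qx → ∧-intro (Q⇒P x qx) qx))
                  (sumWhere-reindex ι Q (λ x → P x ∧ not (Q x)) f partner injective onto) ⟩
      sumWhere Q f ∙ sumWhere Q (f ∘ ι)                         ≈⟨ ∙-cong refl (sumWhere-congᶠ (λ x _ → f∘ι≈f x)) ⟩
      sumWhere Q f ∙ sumWhere Q f                               ∎
      where
      partner : ∀ x → T (Q x) → T (P (ι x) ∧ not (Q (ι x)))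
      partner x qx = ∧-intro (P-ι x (Q⇒P x qx)) (not-intro (Q-once x qx))
      injective : ∀ x y → T (Q x) → T (Q y) → ι x ≡ ι y → x ≡ y
      injective x y _ _ ιx≡ιy = ≡.trans (≡.sym (ι-invol x)) (≡.trans (≡.cong ι ιx≡ιy) (ι-invol y))
      onto : ∀ y → T (P y ∧ not (Q y)) → ∃ λ x → T (Q x) × ι x ≡ y
      onto y q with P⇒Q y (∧-fst q)
      ... | inj₁ qy   = ⊥-elim (not-elim (∧-snd {P y} q) qy)
      ... | inj₂ q-ιy = ι y , q-ιy , ι-invol y

private variable
  n : ℕ
  P Q : Fin n → Bool

-- Defs.sumℕ and Defs.sumℤ are definitionally the sumWhere of these two monoids.
module ℕSum = RestrictedSum NP.+-0-commutativeMonoid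
module ℤSum = RestrictedSum ZP.+-0-commutativeMonoid

sumℕ-mono-≤ : ∀ (P : Fin n → Bool) {f g} → (∀ x → T (P x) → f x ≤ g x) → sumℕ P f ≤ sumℕ P g
sumℕ-mono-≤ {n} P {f} {g} f≤g = go (allFin n)
  where
  go : ∀ xs → foldr (λ x acc → if P x then f x + acc else acc) 0 xs
            ≤ foldr (λ x acc → if P x then g x + acc else acc) 0 xs
  go []       = z≤n
  go (x ∷ xs) with P x | f≤g x
  ... | true  | f≤gₓ = NP.+-mono-≤ (f≤gₓ tt) (go xs)
  ... | false | _    = go xs

sumℕ-const : ∀ (P : Fin n → Bool) c → sumℕ P (λ _ → c) ≡ c * count P
sumℕ-const {n} P c = go (allFin n)
  where
  go : ∀ xs → foldr (λ x acc → if P x then c + acc else acc) 0 xs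
            ≡ c * foldr (λ x acc → if P x then 1 + acc else acc) 0 xs
  go []       = ≡.sym (NP.*-zeroʳ c)
  go (x ∷ xs) with P x
  ... | true  = ≡.trans (≡.cong (c ℕ.+_) (go xs)) (≡.sym (NP.*-suc c _))
  ... | false = go xs

sumℤ-pos : ∀ (P : Fin n → Bool) f → sumℤ P (λ x → + f x) ≡ + sumℕ P f
sumℤ-pos {n} P f = go (allFin n)
  where
  go : ∀ xs → foldr (λ x acc → if P x then + f x ℤ.+ acc else acc) (+ 0) xs
            ≡ + foldr (λ x acc → if P x then f x + acc else acc) 0 xs
  go []       = ≡.refl
  go (x ∷ xs) with P x
  ... | true  = ≡.trans (≡.cong (λ s → + f x ℤ.+ s) (go xs)) (≡.sym (ZP.pos-+ (f x) _))
  ... | false = go xs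

sumℤ-*ʳ : ∀ (P : Fin n → Bool) f k → sumℤ P (λ x → f x ℤ.* k) ≡ sumℤ P f ℤ.* k
sumℤ-*ʳ {n} P f k = go (allFin n)
  where
  go : ∀ xs → foldr (λ x acc → if P x then f x ℤ.* k ℤ.+ acc else acc) (+ 0) xs
            ≡ foldr (λ x acc → if P x then f x ℤ.+ acc else acc) (+ 0) xs ℤ.* k
  go []       = ≡.sym (ZP.*-zeroˡ k)
  go (x ∷ xs) with P x
  ... | true  = ≡.trans (≡.cong (λ s → f x ℤ.* k ℤ.+ s) (go xs)) (≡.sym (ZP.*-distribʳ-+ k (f x) _))
  ... | false = go xs

sumℤ-sub : ∀ (P : Fin n → Bool) f g → sumℤ P (λ x → f x ℤ.- g x) ≡ sumℤ P f ℤ.- sumℤ P g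
sumℤ-sub {n} P f g = go (allFin n)
  where
  go : ∀ xs → foldr (λ x acc → if P x then (f x ℤ.- g x) ℤ.+ acc else acc) (+ 0) xs
            ≡ foldr (λ x acc → if P x then f x ℤ.+ acc else acc) (+ 0) xs
              ℤ.- foldr (λ x acc → if P x then g x ℤ.+ acc else acc) (+ 0) xs
  go []       = ≡.refl
  go (x ∷ xs) with P x
  ... | true  = ≡.trans (≡.cong (λ s → (f x ℤ.- g x) ℤ.+ s) (go xs)) (interchange (f x) (g x) _ _)
    where
    interchange : ∀ a b s t → (a ℤ.- b) ℤ.+ (s ℤ.- t) ≡ (a ℤ.+ s) ℤ.- (b ℤ.+ t)
    interchange = solve-∀
  ... | false = go xs

sumℕ≢0⇒∃ : ∀ (P : Fin n → Bool) f → ¬ sumℕ P f ≡ 0 → ∃ λ x → T (P x) × ¬ f x ≡ 0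
sumℕ≢0⇒∃ {n} P f sum≢0 with ¬∀⟶∃¬ n (λ x → T (P x) → f x ≡ 0) decide (sum≢0 ∘ ℕSum.sumWhere-zero)
  where
  decide : ∀ x → Dec (T (P x) → f x ≡ 0)
  decide x = T? (P x) →-dec (f x NP.≟ 0)
... | x , ¬vanishes with T-or-not (P x)
...   | inj₁ px  = x , px , λ fx≡0 → ¬vanishes (λ _ → fx≡0)
...   | inj₂ ¬px = ⊥-elim (¬vanishes (λ px → ⊥-elim (not-elim ¬px px)))

sumℕ-split-at : ∀ f a → T (P a) → sumℕ P f ≡ f a + sumℕ (λ x → P x ∧ not (x == a)) f
sumℕ-split-at {P = P} f a pa = ≡.trans (ℕSum.sumWhere-split P (_== a) f)
  (≡.cong (_+ sumℕ (λ x → P x ∧ not (x == a)) f)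
          (ℕSum.sumWhere-single a (∧-intro pa (==-refl a)) (λ x q → ==⇒≡ (∧-snd {P x} q))))

term≤sumℕ : ∀ f a → T (P a) → f a ≤ sumℕ P f
term≤sumℕ f a pa = NP.≤-trans (NP.m≤m+n (f a) _) (NP.≤-reflexive (≡.sym (sumℕ-split-at f a pa)))

count-single : ∀ a → T (P a) → (∀ x → T (P x) → x ≡ a) → count P ≡ 1
count-single a = ℕSum.sumWhere-single a

count-pair : ∀ a b → ¬ a ≡ b → T (P a) → T (P b) → (∀ x → T (P x) → x ≡ a ⊎ x ≡ b) → count P ≡ 2
count-pair {P = P} a b a≢b pa pb only = ≡.trans (sumℕ-split-at (λ _ → 1) a pa)
  (≡.cong suc (count-single b (∧-intro pb (not-intro (a≢b ∘ ≡.sym ∘ ==⇒≡))) only-b))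
  where
  only-b : ∀ x → T (P x ∧ not (x == a)) → x ≡ b
  only-b x q with only x (∧-fst q)
  ... | inj₁ x≡a = ⊥-elim (not-elim (∧-snd {P x} q) (≡⇒== x≡a))
  ... | inj₂ x≡b = x≡b

count-mono : (∀ x → T (Q x) → T (P x)) → count Q ≤ count P
count-mono {Q = Q} {P = P} Q⇒P = NP.≤-trans (NP.≤-reflexive (≡.sym common))
  (NP.≤-trans (NP.m≤m+n _ _) (NP.≤-reflexive (≡.sym (ℕSum.sumWhere-split P Q (λ _ → 1)))))
  where
  common : count (λ x → P x ∧ Q x) ≡ count Q
  common = ℕSum.sumWhere-congᴾ (λ x → ∧-snd {P x}) (λ x qx → ∧-intro (Q⇒P x qx) qx)

count-strict-mono : ∀ a → (∀ x → T (Q x) → T (P x)) → T (P a) → ¬ T (Q a) → suc (count Q) ≤ count P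
count-strict-mono {Q = Q} {P = P} a Q⇒P pa ¬qa =
  NP.≤-trans (s≤s (count-mono Q⇒P′)) (NP.≤-reflexive (≡.sym (sumℕ-split-at (λ _ → 1) a pa)))
  where
  Q⇒P′ : ∀ x → T (Q x) → T (P x ∧ not (x == a))
  Q⇒P′ x qx = ∧-intro (Q⇒P x qx) (not-intro (λ x=a → ¬qa (≡.subst (T ∘ Q) (==⇒≡ x=a) qx)))

pos-diff-cong : ∀ {a b c d} → a + c ≡ b + d → + a ℤ.- + d ≡ + b ℤ.- + c
pos-diff-cong {a} {b} {c} {d} a+c≡b+d = begin
  + a ℤ.- + d                  ≡⟨ ZP.m-n≡m⊖n a d ⟩
  a ⊖ d                        ≡⟨ ZP.+-cancelˡ-⊖ c a d ⟨
  (c + a) ⊖ (c + d)            ≡⟨ ≡.cong₂ _⊖_ (≡.trans (NP.+-comm c a) (≡.trans a+c≡b+d (NP.+-comm b d))) (NP.+-comm c d) ⟩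
  (d + b) ⊖ (d + c)            ≡⟨ ZP.+-cancelˡ-⊖ d b c ⟩
  b ⊖ c                        ≡⟨ ZP.m-n≡m⊖n b c ⟨
  + b ℤ.- + c                  ∎
  where open ≡.≡-Reasoning

anyF⇒∃ : ∀ (P : Fin n → Bool) → T (anyF P) → ∃ λ x → T (P x)
anyF⇒∃ {n} P = go (allFin n)
  where
  go : ∀ xs → T (foldr (λ x b → P x ∨ b) false xs) → ∃ λ x → T (P x)
  go (x ∷ xs) q with ∨-case {P x} q
  ... | inj₁ px   = x , px
  ... | inj₂ rest = go xs rest

∃⇒anyF : ∀ (P : Fin n → Bool) x → T (P x) → T (anyF P)
∃⇒anyF {n} P x px = go (∈-allFin x)
  where
  go : ∀ {xs} → x ∈ xs → T (foldr (λ x b → P x ∨ b) false xs)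
  go (here ≡.refl)        = ∨-inl px
  go {y ∷ _} (there x∈xs) = ∨-inr {P y} (go x∈xs)

count-≥2 : ∀ a b → ¬ a ≡ b → T (P a) → T (P b) → 2 ≤ count P
count-≥2 {P = P} a b a≢b pa pb = NP.≤-trans
  (s≤s (NP.≤-reflexive (≡.sym (count-single {P = _== a} a (==-refl a) (λ x → ==⇒≡)))))
  (count-strict-mono b (λ x x=a → ≡.subst (T ∘ P) (≡.sym (==⇒≡ x=a)) pa) pb (a≢b ∘ ≡.sym ∘ ==⇒≡))

Star-crossing : ∀ {a ℓ} {X : Set a} {R : X → X → Set ℓ} (φ : X → Bool) {x y} → Star R x y → T (φ x) → ¬ T (φ y) →
                ∃ λ u → ∃ λ v → R u v × T (φ u) × ¬ T (φ v)
Star-crossing φ Star.ε φx ¬φy = ⊥-elim (¬φy φx)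
Star-crossing φ (_◅_ {j = z} xRz z⋆y) φx ¬φy with T-or-not (φ z)
... | inj₁ φz  = Star-crossing φ z⋆y φz ¬φy
... | inj₂ ¬φz = _ , _ , xRz , φx , not-elim ¬φz

module GraphFacts (G : Graph) where

  open Graph G public using (ι-invol)

  root-isVertex : ∀ x → IsVertex G (rt G x)
  root-isVertex = Graph.r-idem G

  ι-vertex : ∀ {v} → IsVertex G v → iv G v ≡ v
  ι-vertex {v} v-vertex = ≡.trans (≡.cong (iv G) (≡.sym v-vertex)) (≡.trans (Graph.ι-r G v) v-vertex)

  ι-¬vertex : ∀ {x} → ¬ IsVertex G x → ¬ IsVertex G (iv G x)
  ι-¬vertex {x} ¬vx ιx-vertex = ¬vx (≡.subst (IsVertex G) (ι-invol x) (≡.subst (IsVertex G) (≡.sym (ι-vertex ιx-vertex)) ιx-vertex))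

  isV⇒IsVertex : ∀ {x} → T (isV G x) → IsVertex G x
  isV⇒IsVertex = ==⇒≡

  IsVertex⇒isV : ∀ {x} → IsVertex G x → T (isV G x)
  IsVertex⇒isV = ≡⇒==

  edgeRep-half : ∀ {h} → T (isEdgeRep G h) → ¬ IsVertex G h
  edgeRep-half q h-vertex = not-elim (∧-fst q) (IsVertex⇒isV h-vertex)

  edgeRep-< : ∀ {h} → T (isEdgeRep G h) → toℕ h ℕ.< toℕ (iv G h)
  edgeRep-< {h} q = NP.<ᵇ⇒< (toℕ h) (toℕ (iv G h)) (∧-snd {not (isV G h)} q)

  edgeRep-intro : ∀ {h} → ¬ IsVertex G h → toℕ h ℕ.< toℕ (iv G h) → T (isEdgeRep G h)
  edgeRep-intro ¬h-vertex h<ιh = ∧-intro (not-intro (¬h-vertex ∘ isV⇒IsVertex)) (NP.<⇒<ᵇ h<ιh)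

  edgeRep-once : ∀ {h} → T (isEdgeRep G h) → ¬ T (isEdgeRep G (iv G h))
  edgeRep-once {h} q q-ιh = NP.<-asym (edgeRep-< q) (≡.subst (λ y → toℕ (iv G h) ℕ.< toℕ y) (ι-invol h) (edgeRep-< q-ιh))

  edgeRep-either : ∀ {h} → ¬ IsVertex G h → ¬ h ≡ iv G h → T (isEdgeRep G h) ⊎ T (isEdgeRep G (iv G h))
  edgeRep-either {h} ¬h-vertex h≢ιh with NP.<-cmp (toℕ h) (toℕ (iv G h))
  ... | tri< h<ιh _ _ = inj₁ (edgeRep-intro ¬h-vertex h<ιh)
  ... | tri≈ _ h=ιh _ = ⊥-elim (h≢ιh (toℕ-injective h=ιh))
  ... | tri> _ _ ιh<h = inj₂ (edgeRep-intro (ι-¬vertex ¬h-vertex)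
                                            (≡.subst (λ y → toℕ (iv G h) ℕ.< toℕ y) (≡.sym (ι-invol h)) ιh<h))

module ContractionFacts {G G′ : Graph} {S : F G → Bool} {c : F G → F G′} (con : IsContraction G S G′ c) where

  open IsContraction con

  identify : ∀ {x y} → T (S x) → T (S y) → SameComp G S x y → c x ≡ c y
  identify {x} {y} sx sy x~y = Equivalence.from (ident x y) (inj₂ (sx , sy , x~y))

  identified : ∀ {x y} → c x ≡ c y → x ≡ y ⊎ (T (S x) × T (S y) × SameComp G S x y)
  identified {x} {y} = Equivalence.to (ident x y)

  injective-outside : ∀ {x y} → ¬ T (S x) → c x ≡ c y → x ≡ y
  injective-outside ¬sx cx≡cy with identified cx≡cy
  ... | inj₁ x≡y          = x≡y
  ... | inj₂ (sx , _ , _) = ⊥-elim (¬sx sx)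

  contracted-vertex : ∀ {x} → T (S x) → T (S (rt G x)) → SameComp G S x (rt G x) → IsVertex G′ (c x)
  contracted-vertex {x} sx srx x~rx = ≡.trans (≡.sym (root x)) (≡.sym (identify sx srx x~rx))

  sumℕ-lift : ∀ (Q : F G′ → Bool) f → (∀ x → T (Q (c x)) → ¬ T (S x)) →
              sumℕ Q f ≡ sumℕ (λ x → not (S x) ∧ Q (c x)) (f ∘ c)
  sumℕ-lift Q f Q∘c⇒¬S = ℕSum.sumWhere-reindex c _ Q f (λ x q → ∧-snd {not (S x)} q)
    (λ x y q _ cx≡cy → injective-outside (not-elim (∧-fst q)) cx≡cy) onto
    where
    onto : ∀ y → T (Q y) → ∃ λ x → T (not (S x) ∧ Q (c x)) × c x ≡ y
    onto y qy with surj y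
    ... | x , ≡.refl = x , ∧-intro (not-intro (Q∘c⇒¬S x qy)) qy , ≡.refl

module EdgeFacts (G : Graph) (e : F G) (e-half : ¬ IsVertex G e) (e-edge : ¬ iv G e ≡ e) where

  open GraphFacts G

  private
    r ι : F G → F G
    r = rt G
    ι = iv G

  A B : F G
  A = r e
  B = r (ι e)

  A-vertex : IsVertex G A
  A-vertex = root-isVertex e

  B-vertex : IsVertex G B
  B-vertex = root-isVertex (ι e)

  ιe-half : ¬ IsVertex G (ι e)
  ιe-half = ι-¬vertex e-half

  OverE : F G → Set
  OverE y = y ≡ e ⊎ y ≡ ι e

  overE-¬vertex : ∀ {y} → OverE y → ¬ IsVertex G y
  overE-¬vertex (inj₁ ≡.refl) = e-half
  overE-¬vertex (inj₂ ≡.refl) = ιe-half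

  overE-≢ι : ∀ {y} → OverE y → ¬ y ≡ ι y
  overE-≢ι (inj₁ ≡.refl) y≡ιy = e-edge (≡.sym y≡ιy)
  overE-≢ι (inj₂ ≡.refl) y≡ιy = e-edge (≡.trans y≡ιy (ι-invol e))

  overE-ι : ∀ {y} → OverE y → OverE (ι y)
  overE-ι (inj₁ ≡.refl) = inj₂ ≡.refl
  overE-ι (inj₂ ≡.refl) = inj₁ (ι-invol e)

  overE-other : ∀ {y z} → OverE y → OverE z → ¬ y ≡ z → y ≡ ι z
  overE-other (inj₁ ≡.refl) (inj₁ ≡.refl) y≢z = ⊥-elim (y≢z ≡.refl)
  overE-other (inj₁ ≡.refl) (inj₂ ≡.refl) _   = ≡.sym (ι-invol e)
  overE-other (inj₂ ≡.refl) (inj₁ ≡.refl) _   = ≡.refl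
  overE-other (inj₂ ≡.refl) (inj₂ ≡.refl) y≢z = ⊥-elim (y≢z ≡.refl)

  ES : F G → Bool
  ES = edgeS G e

  InES : F G → Set
  InES y = OverE y ⊎ y ≡ A ⊎ y ≡ B

  ES⇒InES : ∀ {y} → T (ES y) → InES y
  ES⇒InES {y} q with ∨-case {y == e} q
  ... | inj₁ y=e = inj₁ (inj₁ (==⇒≡ y=e))
  ... | inj₂ q′ with ∨-case {y == ι e} q′
  ...   | inj₁ y=ιe = inj₁ (inj₂ (==⇒≡ y=ιe))
  ...   | inj₂ q″ with ∨-case {y == A} q″
  ...     | inj₁ y=A = inj₂ (inj₁ (==⇒≡ y=A))
  ...     | inj₂ y=B = inj₂ (inj₂ (==⇒≡ y=B))

  InES⇒ES : ∀ {y} → InES y → T (ES y)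
  InES⇒ES {y} (inj₁ (inj₁ y≡e))  = ∨-inl (≡⇒== y≡e)
  InES⇒ES {y} (inj₁ (inj₂ y≡ιe)) = ∨-inr {y == e} (∨-inl (≡⇒== y≡ιe))
  InES⇒ES {y} (inj₂ (inj₁ y≡A))  = ∨-inr {y == e} (∨-inr {y == ι e} (∨-inl (≡⇒== y≡A)))
  InES⇒ES {y} (inj₂ (inj₂ y≡B))  = ∨-inr {y == e} (∨-inr {y == ι e} (∨-inr {y == A} (≡⇒== y≡B)))

  overE⇒ES : ∀ {y} → OverE y → T (ES y)
  overE⇒ES = InES⇒ES ∘ inj₁

  A∈ES : T (ES A)
  A∈ES = InES⇒ES (inj₂ (inj₁ ≡.refl))

  B∈ES : T (ES B)
  B∈ES = InES⇒ES (inj₂ (inj₂ ≡.refl))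

  ES-connected : ∀ {y} → T (ES y) → SameComp G ES e y
  ES-connected {y} q with ES⇒InES {y} q
  ... | inj₁ (inj₁ ≡.refl) = Star.ε
  ... | inj₁ (inj₂ ≡.refl) = (overE⇒ES (inj₁ ≡.refl) , q , inj₂ (inj₁ ≡.refl)) ◅ Star.ε
  ... | inj₂ (inj₁ ≡.refl) = (overE⇒ES (inj₁ ≡.refl) , q , inj₁ ≡.refl) ◅ Star.ε
  ... | inj₂ (inj₂ ≡.refl) =
    (overE⇒ES (inj₁ ≡.refl) , ιe∈ES , inj₂ (inj₁ ≡.refl)) ◅ (ιe∈ES , q , inj₁ ≡.refl) ◅ Star.ε
    where
    ιe∈ES : T (ES (ι e))
    ιe∈ES = overE⇒ES (inj₂ ≡.refl)

  ES-vertex : ∀ {y} → T (ES y) → IsVertex G y → y ≡ A ⊎ y ≡ B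
  ES-vertex {y} q y-vertex with ES⇒InES {y} q
  ... | inj₁ y-overE = ⊥-elim (overE-¬vertex y-overE y-vertex)
  ... | inj₂ y≡A⊎B   = y≡A⊎B

  outsideAt : F G → ℕ
  outsideAt a = count (λ y → not (ES y) ∧ (r y == a))

  outsideAtAB : ℕ
  outsideAtAB = count (λ y → not (ES y) ∧ ES (r y))

  private
    rootedAt-split : ∀ a → count (λ y → r y == a) ≡ count (λ y → (r y == a) ∧ ES y) + outsideAt a
    rootedAt-split a = ≡.trans (ℕSum.sumWhere-split _ ES (λ _ → 1)) (≡.cong (λ k → count (λ y → (r y == a) ∧ ES y) + k)
      (ℕSum.sumWhere-congᴾ (λ y q → ∧-intro (∧-snd {r y == a} q) (∧-fst {r y == a} q))
                           (λ y q → ∧-intro (∧-snd {not (ES y)} q) (∧-fst {not (ES y)} q))))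

    val-minus-2 : ∀ {a} k → count (λ y → r y == a) ≡ k + outsideAt a → val G a ℤ.- + 2 ≡ + outsideAt a ℤ.+ (+ k ℤ.- + 3)
    val-minus-2 {a} k count≡ = ≡.trans (≡.cong (λ c → + c ℤ.- + 1 ℤ.- + 2) count≡)
      (≡.trans (≡.cong (λ c → c ℤ.- + 1 ℤ.- + 2) (ZP.pos-+ k (outsideAt a))) (shuffle (+ k) (+ outsideAt a)))
      where
      shuffle : ∀ k M → k ℤ.+ M ℤ.- + 1 ℤ.- + 2 ≡ M ℤ.+ (k ℤ.- + 3)
      shuffle = solve-∀

    A≢e : ¬ A ≡ e
    A≢e A≡e = e-half (≡.subst (IsVertex G) A≡e A-vertex)

    B≢ιe : ¬ B ≡ ι e
    B≢ιe B≡ιe = ιe-half (≡.subst (IsVertex G) B≡ιe B-vertex)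

    rootedAt-A : ¬ A ≡ B → count (λ y → r y == A) ≡ 2 + outsideAt A
    rootedAt-A A≢B = ≡.trans (rootedAt-split A) (≡.cong (_+ outsideAt A)
      (count-pair A e A≢e (∧-intro (≡⇒== A-vertex) A∈ES) (∧-intro (==-refl A) (overE⇒ES (inj₁ ≡.refl))) only))
      where
      only : ∀ y → T ((r y == A) ∧ ES y) → y ≡ A ⊎ y ≡ e
      only y q with ES⇒InES {y} (∧-snd {r y == A} q)
      ... | inj₁ (inj₁ y≡e)  = inj₂ y≡e
      ... | inj₁ (inj₂ ≡.refl) = ⊥-elim (A≢B (≡.sym (==⇒≡ (∧-fst q))))
      ... | inj₂ (inj₁ y≡A)  = inj₁ y≡A
      ... | inj₂ (inj₂ ≡.refl) = ⊥-elim (A≢B (≡.trans (≡.sym (==⇒≡ (∧-fst q))) B-vertex))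

    rootedAt-B : ¬ A ≡ B → count (λ y → r y == B) ≡ 2 + outsideAt B
    rootedAt-B A≢B = ≡.trans (rootedAt-split B) (≡.cong (_+ outsideAt B)
      (count-pair B (ι e) B≢ιe (∧-intro (≡⇒== B-vertex) B∈ES) (∧-intro (==-refl B) (overE⇒ES (inj₂ ≡.refl))) only))
      where
      only : ∀ y → T ((r y == B) ∧ ES y) → y ≡ B ⊎ y ≡ ι e
      only y q with ES⇒InES {y} (∧-snd {r y == B} q)
      ... | inj₁ (inj₁ ≡.refl) = ⊥-elim (A≢B (==⇒≡ (∧-fst q)))
      ... | inj₁ (inj₂ y≡ιe) = inj₂ y≡ιe
      ... | inj₂ (inj₁ ≡.refl) = ⊥-elim (A≢B (≡.trans (≡.sym A-vertex) (==⇒≡ (∧-fst q))))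
      ... | inj₂ (inj₂ y≡B)  = inj₁ y≡B

    outsideAtAB-split : ¬ A ≡ B → outsideAtAB ≡ outsideAt A + outsideAt B
    outsideAtAB-split A≢B = ≡.trans (ℕSum.sumWhere-split _ (λ y → r y == A) (λ _ → 1))
      (≡.cong₂ _+_ (ℕSum.sumWhere-congᴾ at-A (λ y q → ∧-intro (∧-intro (∧-fst q) (A∈ES-root y q)) (∧-snd {not (ES y)} q)))
                   (ℕSum.sumWhere-congᴾ at-B (λ y q → ∧-intro (∧-intro (∧-fst q) (B∈ES-root y q)) (B≠A y q))))
      where
      A∈ES-root : ∀ y → T (not (ES y) ∧ (r y == A)) → T (ES (r y))
      A∈ES-root y q = ≡.subst (T ∘ ES) (≡.sym (==⇒≡ (∧-snd {not (ES y)} q))) A∈ES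
      B∈ES-root : ∀ y → T (not (ES y) ∧ (r y == B)) → T (ES (r y))
      B∈ES-root y q = ≡.subst (T ∘ ES) (≡.sym (==⇒≡ (∧-snd {not (ES y)} q))) B∈ES
      B≠A : ∀ y → T (not (ES y) ∧ (r y == B)) → T (not (r y == A))
      B≠A y q = not-intro (λ ry=A → A≢B (≡.trans (≡.sym (==⇒≡ ry=A)) (==⇒≡ (∧-snd {not (ES y)} q))))
      at-A : ∀ y → T ((not (ES y) ∧ ES (r y)) ∧ (r y == A)) → T (not (ES y) ∧ (r y == A))
      at-A y q = ∧-intro (∧-fst (∧-fst q)) (∧-snd {not (ES y) ∧ ES (r y)} q)
      at-B : ∀ y → T ((not (ES y) ∧ ES (r y)) ∧ not (r y == A)) → T (not (ES y) ∧ (r y == B))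
      at-B y q with ES-vertex {r y} (∧-snd {not (ES y)} (∧-fst q)) (root-isVertex y)
      ... | inj₁ ry≡A = ⊥-elim (not-elim (∧-snd {not (ES y) ∧ ES (r y)} q) (≡⇒== ry≡A))
      ... | inj₂ ry≡B = ∧-intro (∧-fst (∧-fst q)) (≡⇒== ry≡B)

  val-A+val-B : ¬ A ≡ B → (val G A ℤ.- + 2) ℤ.+ (val G B ℤ.- + 2) ≡ + outsideAtAB ℤ.- + 2
  val-A+val-B A≢B = begin
    (val G A ℤ.- + 2) ℤ.+ (val G B ℤ.- + 2)
      ≡⟨ ≡.cong₂ ℤ._+_ (val-minus-2 2 (rootedAt-A A≢B)) (val-minus-2 2 (rootedAt-B A≢B)) ⟩
    (+ outsideAt A ℤ.+ (+ 2 ℤ.- + 3)) ℤ.+ (+ outsideAt B ℤ.+ (+ 2 ℤ.- + 3))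
      ≡⟨ regroup (+ outsideAt A) (+ outsideAt B) ⟩
    (+ outsideAt A ℤ.+ + outsideAt B) ℤ.- + 2
      ≡⟨ ≡.cong (λ c → c ℤ.- + 2) (≡.trans (≡.sym (ZP.pos-+ (outsideAt A) _)) (≡.cong +_ (≡.sym (outsideAtAB-split A≢B)))) ⟩
    + outsideAtAB ℤ.- + 2 ∎
    where
    open ≡.≡-Reasoning
    regroup : ∀ a b → (a ℤ.+ (+ 2 ℤ.- + 3)) ℤ.+ (b ℤ.+ (+ 2 ℤ.- + 3)) ≡ (a ℤ.+ b) ℤ.- + 2
    regroup = solve-∀

  module Collapsed {G′ : Graph} {p : F G → F G′} (con : IsContraction G ES G′ p) where

    open ContractionFacts con public
    open IsContraction con using (root)

    collapse : ∀ {y} → T (ES y) → p y ≡ p e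
    collapse q = ≡.sym (identify (overE⇒ES (inj₁ ≡.refl)) q (ES-connected q))

    collapse⁻¹ : ∀ {y} → p y ≡ p e → T (ES y)
    collapse⁻¹ {y} py≡pe with identified py≡pe
    ... | inj₁ ≡.refl          = overE⇒ES (inj₁ ≡.refl)
    ... | inj₂ (ES-y , _ , _)  = ES-y

    Vₑ-vertex : IsVertex G′ (p e)
    Vₑ-vertex = contracted-vertex (overE⇒ES (inj₁ ≡.refl)) A∈ES (ES-connected A∈ES)

    rootedAt-Vₑ : count (λ H → rt G′ H == p e) ≡ suc outsideAtAB
    rootedAt-Vₑ = ≡.trans (sumℕ-split-at (λ _ → 1) (p e) (≡⇒== Vₑ-vertex))
      (≡.cong suc (≡.trans (sumℕ-lift _ (λ _ → 1) (λ y q ES-y → not-elim (∧-snd {rt G′ (p y) == p e} q) (≡⇒== (collapse ES-y))))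
        (ℕSum.sumWhere-congᴾ to from)))
      where
      to : ∀ y → T (not (ES y) ∧ ((rt G′ (p y) == p e) ∧ not (p y == p e))) → T (not (ES y) ∧ ES (r y))
      to y q = ∧-intro (∧-fst q) (collapse⁻¹ (≡.trans (root y) (==⇒≡ (∧-fst (∧-snd {not (ES y)} q)))))
      from : ∀ y → T (not (ES y) ∧ ES (r y)) → T (not (ES y) ∧ ((rt G′ (p y) == p e) ∧ not (p y == p e)))
      from y q = ∧-intro ¬ES-y (∧-intro (≡⇒== (≡.trans (≡.sym (root y)) (collapse (∧-snd {not (ES y)} q))))
                                         (not-intro (not-elim ¬ES-y ∘ collapse⁻¹ ∘ ==⇒≡)))
        where
        ¬ES-y : T (not (ES y))
        ¬ES-y = ∧-fst {not (ES y)} q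

    val-Vₑ : val G′ (p e) ≡ + outsideAtAB
    val-Vₑ = ≡.cong (λ c → + c ℤ.- + 1) rootedAt-Vₑ

    vertex-preimage : ∀ {y} → IsVertex G′ (p y) → IsVertex G y ⊎ OverE y
    vertex-preimage {y} py-vertex with identified (≡.trans (root y) py-vertex)
    ... | inj₁ y-vertex = inj₁ y-vertex
    ... | inj₂ (_ , ES-y , _) with ES⇒InES {y} ES-y
    ...   | inj₁ y-overE   = inj₂ y-overE
    ...   | inj₂ (inj₁ y≡A) = inj₁ (≡.subst (IsVertex G) (≡.sym y≡A) A-vertex)
    ...   | inj₂ (inj₂ y≡B) = inj₁ (≡.subst (IsVertex G) (≡.sym y≡B) B-vertex)

module Preimage (G₁ G₂ : Graph) (π : F G₁ → F G₂) (d : F G₁ → ℕ) (harm : IsHarmonic G₁ G₂ π d)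
                (e : F G₂) (e-half : ¬ IsVertex G₂ e) (e-edge : ¬ iv G₂ e ≡ e) where

  open IsHarmonic harm
  open EdgeFacts G₂ e e-half e-edge public
  module G₁ = GraphFacts G₁
  module G₂ = GraphFacts G₂

  r₁ ι₁ : F G₁ → F G₁
  r₁ = rt G₁
  ι₁ = iv G₁

  r₂ ι₂ : F G₂ → F G₂
  r₂ = rt G₂
  ι₂ = iv G₂

  S : F G₁ → Bool
  S = preimS G₁ G₂ π e

  π-vertex : ∀ {x} → IsVertex G₁ x → IsVertex G₂ (π x)
  π-vertex {x} x-vertex = ≡.trans (≡.sym (comm-r x)) (≡.cong π x-vertex)

  overE-half : ∀ {x} → OverE (π x) → ¬ IsVertex G₁ x
  overE-half πx-overE x-vertex = overE-¬vertex πx-overE (π-vertex x-vertex)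

  HalfOverE : F G₁ → Bool
  HalfOverE = preHalf G₁ G₂ π e

  halfOverE-intro : ∀ {x} → OverE (π x) → T (HalfOverE x)
  halfOverE-intro {x} πx-overE = ∧-intro (not-intro (overE-half πx-overE ∘ G₁.isV⇒IsVertex)) (over πx-overE)
    where
    over : OverE (π x) → T ((π x == e) ∨ (π x == ι₂ e))
    over (inj₁ πx≡e)  = ∨-inl (≡⇒== πx≡e)
    over (inj₂ πx≡ιe) = ∨-inr {π x == e} (≡⇒== πx≡ιe)

  halfOverE-overE : ∀ {x} → T (HalfOverE x) → OverE (π x)
  halfOverE-overE {x} q with ∨-case {π x == e} (∧-snd {not (isV G₁ x)} q)
  ... | inj₁ πx=e  = inj₁ (==⇒≡ πx=e)
  ... | inj₂ πx=ιe = inj₂ (==⇒≡ πx=ιe)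

  overE⇒S : ∀ {x} → OverE (π x) → T (S x)
  overE⇒S = ∨-inl ∘ halfOverE-intro

  S-cases : ∀ {x} → T (S x) → OverE (π x) ⊎ (∃ λ h → OverE (π h) × r₁ h ≡ x)
  S-cases {x} q with ∨-case {HalfOverE x} q
  ... | inj₁ half = inj₁ (halfOverE-overE half)
  ... | inj₂ q′ with anyF⇒∃ _ q′
  ...   | h , q″ = inj₂ (h , halfOverE-overE (∧-fst q″) , ==⇒≡ (∧-snd {HalfOverE h} q″))

  S-root-of-overE : ∀ {h} → OverE (π h) → T (S (r₁ h))
  S-root-of-overE {h} πh-overE = ∨-inr {HalfOverE (r₁ h)} (∃⇒anyF _ h (∧-intro (halfOverE-intro πh-overE) (==-refl (r₁ h))))

  S-root : ∀ {x} → T (S x) → T (S (r₁ x))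
  S-root {x} q with S-cases q
  ... | inj₁ πx-overE                = S-root-of-overE πx-overE
  ... | inj₂ (h , πh-overE , ≡.refl) = ≡.subst (T ∘ S) (≡.sym (G₁.root-isVertex h)) (S-root-of-overE πh-overE)

  S-vertex-or-overE : ∀ {x} → T (S x) → IsVertex G₁ x ⊎ OverE (π x)
  S-vertex-or-overE q with S-cases q
  ... | inj₁ πx-overE         = inj₂ πx-overE
  ... | inj₂ (h , _ , ≡.refl) = inj₁ (G₁.root-isVertex h)

  S-half⇒overE : ∀ {x} → T (S x) → ¬ IsVertex G₁ x → OverE (π x)
  S-half⇒overE q ¬x-vertex with S-vertex-or-overE q
  ... | inj₁ x-vertex  = ⊥-elim (¬x-vertex x-vertex)
  ... | inj₂ πx-overE = πx-overE

  S-half-≢ι : ∀ {x} → T (S x) → ¬ IsVertex G₁ x → ¬ x ≡ ι₁ x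
  S-half-≢ι {x} q ¬x-vertex x≡ιx = overE-≢ι (S-half⇒overE q ¬x-vertex) (≡.trans (≡.cong π x≡ιx) (comm-ι x))

  S-ι : ∀ {x} → T (S x) → T (S (ι₁ x))
  S-ι {x} q with S-vertex-or-overE q
  ... | inj₁ x-vertex  = ≡.subst (T ∘ S) (≡.sym (G₁.ι-vertex x-vertex)) q
  ... | inj₂ πx-overE = overE⇒S (≡.subst OverE (≡.sym (comm-ι x)) (overE-ι πx-overE))

  ¬S-ι : ∀ {x} → ¬ T (S x) → ¬ T (S (ι₁ x))
  ¬S-ι {x} ¬q = ¬q ∘ ≡.subst (T ∘ S) (G₁.ι-invol x) ∘ S-ι

  S~root : ∀ {x} → T (S x) → SameComp G₁ S x (r₁ x)
  S~root {x} q with S-cases q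
  ... | inj₁ _                = (q , S-root q , inj₁ ≡.refl) ◅ Star.ε
  ... | inj₂ (h , _ , ≡.refl) = ≡.subst (SameComp G₁ S (r₁ h)) (≡.sym (G₁.root-isVertex h)) Star.ε

  S~ι : ∀ {x} → T (S x) → SameComp G₁ S x (ι₁ x)
  S~ι q = (q , S-ι q , inj₂ (inj₁ ≡.refl)) ◅ Star.ε

  S⇒ES∘π : ∀ {x} → T (S x) → T (ES (π x))
  S⇒ES∘π q with S-cases q
  ... | inj₁ πx-overE = overE⇒ES πx-overE
  ... | inj₂ (h , inj₁ πh≡e , ≡.refl)  = InES⇒ES (inj₂ (inj₁ (≡.trans (comm-r h) (≡.cong r₂ πh≡e))))
  ... | inj₂ (h , inj₂ πh≡ιe , ≡.refl) = InES⇒ES (inj₂ (inj₂ (≡.trans (comm-r h) (≡.cong r₂ πh≡ιe))))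

  FibreAt : F G₂ → F G₁ → F G₁ → Bool
  FibreAt z V x = (π x == z) ∧ (r₁ x == V)

  harmonic-fibre : ∀ {V z} → IsVertex G₁ V → ¬ IsVertex G₂ z → r₂ z ≡ π V → sumℕ (FibreAt z V) d ≡ d V
  harmonic-fibre {V} {z} V-vertex z-half rz≡πV =
    ≡.sym (harmonic V V-vertex z rz≡πV (λ z≡πV → z-half (≡.subst (IsVertex G₂) (≡.sym z≡πV) (π-vertex V-vertex))))

  empty-fibre : ∀ {V z} → ¬ r₂ z ≡ π V → sumℕ (FibreAt z V) d ≡ 0
  empty-fibre {V} {z} rz≢πV = ℕSum.sumWhere-empty (λ x q → rz≢πV
    (≡.trans (≡.cong r₂ (≡.sym (==⇒≡ (∧-fst q)))) (≡.trans (≡.sym (comm-r x)) (≡.cong π (==⇒≡ (∧-snd {π x == z} q))))))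

  degree-vanishes-off-S : ∀ {v z} → IsVertex G₁ v → ¬ T (S v) → OverE z → π v ≡ r₂ z → d v ≡ 0
  degree-vanishes-off-S {v} {z} v-vertex ¬Sv z-overE πv≡rz =
    ≡.trans (≡.sym (harmonic-fibre v-vertex (overE-¬vertex z-overE) (≡.sym πv≡rz))) (ℕSum.sumWhere-empty no-half)
    where
    no-half : ∀ x → ¬ T (FibreAt z v x)
    no-half x q = ¬Sv (≡.subst (T ∘ S) (==⇒≡ (∧-snd {π x == z} q))
                        (S-root (overE⇒S (≡.subst OverE (≡.sym (==⇒≡ (∧-fst q))) z-overE))))

  module Forest (m : ℕ) (comp : F G₁ → Fin m)
    (comp-spec : ∀ x y → T (S x) → T (S y) → ((comp x ≡ comp y) ⇔ SameComp G₁ S x y)) where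

    comp-≡ : ∀ {x y} → T (S x) → T (S y) → SameComp G₁ S x y → comp x ≡ comp y
    comp-≡ {x} {y} sx sy x~y = Equivalence.from (comp-spec x y sx sy) x~y

    comp-root : ∀ {x} → T (S x) → comp (r₁ x) ≡ comp x
    comp-root sx = ≡.sym (comp-≡ sx (S-root sx) (S~root sx))

    comp-ι : ∀ {x} → T (S x) → comp (ι₁ x) ≡ comp x
    comp-ι sx = ≡.sym (comp-≡ sx (S-ι sx) (S~ι sx))

    InTree : Fin m → F G₁ → Bool
    InTree i x = S x ∧ (comp x == i)

    TreeVertex TreeEdge : Fin m → F G₁ → Bool
    TreeVertex i V = isV G₁ V ∧ InTree i V
    TreeEdge i h = isEdgeRep G₁ h ∧ InTree i h

    module _ {i : Fin m} where

      inTree-intro : ∀ {x} → T (S x) → comp x ≡ i → T (InTree i x)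
      inTree-intro sx cx≡i = ∧-intro sx (≡⇒== cx≡i)

      inTree-S : ∀ {x} → T (InTree i x) → T (S x)
      inTree-S = ∧-fst

      inTree-comp : ∀ {x} → T (InTree i x) → comp x ≡ i
      inTree-comp {x} q = ==⇒≡ (∧-snd {S x} q)

      inTree-root : ∀ {x} → T (InTree i x) → T (InTree i (r₁ x))
      inTree-root q = inTree-intro (S-root (inTree-S q)) (≡.trans (comp-root (inTree-S q)) (inTree-comp q))

      inTree-ι : ∀ {x} → T (InTree i x) → T (InTree i (ι₁ x))
      inTree-ι q = inTree-intro (S-ι (inTree-S q)) (≡.trans (comp-ι (inTree-S q)) (inTree-comp q))

      inTree-at-root : ∀ {x} → T (S x) → T (InTree i (r₁ x)) → T (InTree i x)
      inTree-at-root sx q = inTree-intro sx (≡.trans (≡.sym (comp-root sx)) (inTree-comp q))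

      treeVertex-intro : ∀ {V} → IsVertex G₁ V → T (InTree i V) → T (TreeVertex i V)
      treeVertex-intro V-vertex q = ∧-intro (G₁.IsVertex⇒isV V-vertex) q

      treeVertex-vertex : ∀ {V} → T (TreeVertex i V) → IsVertex G₁ V
      treeVertex-vertex q = G₁.isV⇒IsVertex (∧-fst q)

      treeVertex-inTree : ∀ {V} → T (TreeVertex i V) → T (InTree i V)
      treeVertex-inTree {V} = ∧-snd {isV G₁ V}

      treeEdge-inTree : ∀ {h} → T (TreeEdge i h) → T (InTree i h)
      treeEdge-inTree {h} = ∧-snd {isEdgeRep G₁ h}

      treeVertex-over-AB : ∀ {V} → T (TreeVertex i V) → π V ≡ A ⊎ π V ≡ B
      treeVertex-over-AB q = ES-vertex (S⇒ES∘π (inTree-S (treeVertex-inTree q))) (π-vertex (treeVertex-vertex q))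

      treeVertex-over-loop : A ≡ B → ∀ {V} → T (TreeVertex i V) → π V ≡ A
      treeVertex-over-loop A≡B q with treeVertex-over-AB q
      ... | inj₁ πV≡A = πV≡A
      ... | inj₂ πV≡B = ≡.trans πV≡B (≡.sym A≡B)

    treeDegree : Fin m → ℕ
    treeDegree i = sumℕ (TreeEdge i) d

    HalfOver : F G₂ → Fin m → F G₁ → Bool
    HalfOver z i x = (π x == z) ∧ (comp x == i)

    module _ {z : F G₂} (z-overE : OverE z) (i : Fin m) where

      private
        over-z : ∀ {x} → T (HalfOver z i x) → π x ≡ z
        over-z q = ==⇒≡ (∧-fst q)

        half-inTree : ∀ {x} → T (HalfOver z i x) → T (InTree i x)
        half-inTree {x} q = inTree-intro (overE⇒S (≡.subst OverE (≡.sym (over-z q)) z-overE)) (==⇒≡ (∧-snd {π x == z} q))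

      -- Each edge of a tree has exactly one half over z, and d is ι-invariant.
      treeDegree-halves : treeDegree i ≡ sumℕ (HalfOver z i) d
      treeDegree-halves = ℕSum.sumWhere-transversal ι₁ G₁.ι-invol deg-ι edge⇒half half⇒edge
        (λ h q → G₁.edgeRep-once (∧-fst q) ∘ ∧-fst) half-once
        where
        edge⇒half : ∀ h → T (TreeEdge i h) → T (HalfOver z i h) ⊎ T (HalfOver z i (ι₁ h))
        edge⇒half h q with T-or-not (π h == z)
        ... | inj₁ πh=z = inj₁ (∧-intro πh=z (≡⇒== (inTree-comp (treeEdge-inTree q))))
        ... | inj₂ πh≠z = inj₂ (∧-intro (≡⇒== πιh≡z) (≡⇒== (inTree-comp (inTree-ι (treeEdge-inTree q)))))
          where
          πh-overE : OverE (π h)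
          πh-overE = S-half⇒overE (inTree-S (treeEdge-inTree q)) (G₁.edgeRep-half (∧-fst q))
          πιh≡z : π (ι₁ h) ≡ z
          πιh≡z = ≡.trans (comm-ι h)
                    (≡.trans (≡.cong ι₂ (overE-other πh-overE z-overE (not-elim πh≠z ∘ ≡⇒==))) (G₂.ι-invol z))
        half⇒edge : ∀ x → T (HalfOver z i x) → T (TreeEdge i x) ⊎ T (TreeEdge i (ι₁ x))
        half⇒edge x q with G₁.edgeRep-either x-half (S-half-≢ι (inTree-S (half-inTree q)) x-half)
          where
          x-half : ¬ IsVertex G₁ x
          x-half = overE-half (≡.subst OverE (≡.sym (over-z q)) z-overE)
        ... | inj₁ rep   = inj₁ (∧-intro rep (half-inTree q))
        ... | inj₂ rep-ι = inj₂ (∧-intro rep-ι (inTree-ι (half-inTree q)))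
        half-once : ∀ x → T (HalfOver z i x) → ¬ T (HalfOver z i (ι₁ x))
        half-once x q q-ι = overE-≢ι z-overE (≡.trans (≡.sym (over-z q-ι)) (≡.trans (comm-ι x) (≡.cong ι₂ (over-z q))))

      treeVertices-halves : sumℕ (λ V → TreeVertex i V ∧ (π V == r₂ z)) d ≡ sumℕ (HalfOver z i) d
      treeVertices-halves = ≡.sym (≡.trans (ℕSum.sumWhere-fibres (HalfOver z i) d r₁ _ root-over) (ℕSum.sumWhere-congᶠ fibre))
        where
        root-over : ∀ x → T (HalfOver z i x) → T (TreeVertex i (r₁ x) ∧ (π (r₁ x) == r₂ z))
        root-over x q = ∧-intro (treeVertex-intro (G₁.root-isVertex x) (inTree-root (half-inTree q)))
                                (≡⇒== (≡.trans (comm-r x) (≡.cong r₂ (over-z q))))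
        fibre : ∀ V → T (TreeVertex i V ∧ (π V == r₂ z)) → sumℕ (λ x → HalfOver z i x ∧ (r₁ x == V)) d ≡ d V
        fibre V q = ≡.trans (ℕSum.sumWhere-congᴾ forget remember)
          (harmonic-fibre (treeVertex-vertex V-tree) (overE-¬vertex z-overE) (≡.sym (==⇒≡ (∧-snd {TreeVertex i V} q))))
          where
          V-tree : T (TreeVertex i V)
          V-tree = ∧-fst q
          forget : ∀ x → T (HalfOver z i x ∧ (r₁ x == V)) → T (FibreAt z V x)
          forget x q′ = ∧-intro (∧-fst (∧-fst q′)) (∧-snd {HalfOver z i x} q′)
          remember : ∀ x → T (FibreAt z V x) → T (HalfOver z i x ∧ (r₁ x == V))
          remember x q′ = ∧-intro (∧-intro (∧-fst q′) (≡⇒== (inTree-comp (inTree-at-root sx rx-tree)))) (∧-snd {π x == z} q′)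
            where
            sx : T (S x)
            sx = overE⇒S (≡.subst OverE (≡.sym (==⇒≡ (∧-fst q′))) z-overE)
            rx-tree : T (InTree i (r₁ x))
            rx-tree = ≡.subst (T ∘ InTree i) (≡.sym (==⇒≡ (∧-snd {π x == z} q′))) (treeVertex-inTree V-tree)

      treeVertices-over-degree : sumℕ (λ V → TreeVertex i V ∧ (π V == r₂ z)) d ≡ treeDegree i
      treeVertices-over-degree = ≡.trans treeVertices-halves (≡.sym treeDegree-halves)

    module _ (i : Fin m) where

      treeHalves : ∀ (Z : F G₁ → Bool) → (∀ h → Z (ι₁ h) ≡ Z h) →
        count (λ H → (InTree i H ∧ not (isV G₁ H)) ∧ Z H) ≡ count (λ h → TreeEdge i h ∧ Z h) + count (λ h → TreeEdge i h ∧ Z h)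
      treeHalves Z Z∘ι = ℕSum.sumWhere-pairs ι₁ G₁.ι-invol (λ _ → ≡.refl) half⇒edge edge⇒half half-ι
        (λ h q → G₁.edgeRep-once (∧-fst (∧-fst q)) ∘ ∧-fst ∘ ∧-fst)
        where
        half-ι : ∀ x → T ((InTree i x ∧ not (isV G₁ x)) ∧ Z x) → T ((InTree i (ι₁ x) ∧ not (isV G₁ (ι₁ x))) ∧ Z (ι₁ x))
        half-ι x q = ∧-intro (∧-intro (inTree-ι (∧-fst (∧-fst q)))
                                      (not-intro (G₁.ι-¬vertex (not-elim (∧-snd {InTree i x} (∧-fst q)) ∘ G₁.IsVertex⇒isV) ∘ G₁.isV⇒IsVertex)))
                             (≡.subst T (≡.sym (Z∘ι x)) (∧-snd {InTree i x ∧ not (isV G₁ x)} q))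
        edge⇒half : ∀ h → T (TreeEdge i h ∧ Z h) → T ((InTree i h ∧ not (isV G₁ h)) ∧ Z h)
        edge⇒half h q = ∧-intro (∧-intro (treeEdge-inTree (∧-fst q)) (not-intro (G₁.edgeRep-half (∧-fst (∧-fst q)) ∘ G₁.isV⇒IsVertex)))
                                (∧-snd {TreeEdge i h} q)
        half⇒edge : ∀ x → T ((InTree i x ∧ not (isV G₁ x)) ∧ Z x) → T (TreeEdge i x ∧ Z x) ⊎ T (TreeEdge i (ι₁ x) ∧ Z (ι₁ x))
        half⇒edge x q with G₁.edgeRep-either x-half (S-half-≢ι (inTree-S x-tree) x-half)
          where
          x-tree : T (InTree i x)
          x-tree = ∧-fst (∧-fst q)
          x-half : ¬ IsVertex G₁ x
          x-half = not-elim (∧-snd {InTree i x} (∧-fst q)) ∘ G₁.IsVertex⇒isV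
        ... | inj₁ rep   = inj₁ (∧-intro (∧-intro rep (∧-fst (∧-fst q))) (∧-snd {InTree i x ∧ not (isV G₁ x)} q))
        ... | inj₂ rep-ι = inj₂ (∧-intro (∧-intro rep-ι (∧-fst (∧-fst ιx-half))) (∧-snd {InTree i (ι₁ x) ∧ not (isV G₁ (ι₁ x))} ιx-half))
          where
          ιx-half : T ((InTree i (ι₁ x) ∧ not (isV G₁ (ι₁ x))) ∧ Z (ι₁ x))
          ιx-half = half-ι x q

      outsideAtTree treeVertexCount treeEdgeCount : ℕ
      outsideAtTree = count (λ y → not (S y) ∧ InTree i (r₁ y))
      treeVertexCount = count (TreeVertex i)
      treeEdgeCount = count (TreeEdge i)

      private
        count-∧true : ∀ (P : F G₁ → Bool) → count (λ x → P x ∧ true) ≡ count P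
        count-∧true P = ℕSum.sumWhere-cong (λ x → ∧-identityʳ (P x)) (λ _ _ → ≡.refl)

        count-inTree : count (InTree i) ≡ treeVertexCount + (treeEdgeCount + treeEdgeCount)
        count-inTree = ≡.trans (ℕSum.sumWhere-split (InTree i) (isV G₁) (λ _ → 1)) (≡.cong₂ _+_
          (ℕSum.sumWhere-congᴾ (λ x q → ∧-intro (∧-snd {InTree i x} q) (∧-fst q)) (λ x q → ∧-intro (∧-snd {isV G₁ x} q) (∧-fst q)))
          (≡.trans (≡.sym (count-∧true _)) (≡.trans (treeHalves (λ _ → true) (λ _ → ≡.refl))
            (≡.cong₂ _+_ (count-∧true (TreeEdge i)) (count-∧true (TreeEdge i))))))

      sum-rootedAt : sumℕ (TreeVertex i) (λ V → count (λ H → r₁ H == V))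
                     ≡ outsideAtTree + (treeVertexCount + (treeEdgeCount + treeEdgeCount))
      sum-rootedAt = begin
        sumℕ (TreeVertex i) (λ V → count (λ H → r₁ H == V))
          ≡⟨ ℕSum.sumWhere-congᶠ only-tree-roots ⟩
        sumℕ (TreeVertex i) (λ V → count (λ H → R H ∧ (r₁ H == V)))
          ≡⟨ ℕSum.sumWhere-fibres R (λ _ → 1) r₁ (TreeVertex i) (λ H q → treeVertex-intro (G₁.root-isVertex H) q) ⟨
        count R
          ≡⟨ ℕSum.sumWhere-split R S (λ _ → 1) ⟩
        count (λ H → R H ∧ S H) + count (λ H → R H ∧ not (S H))
          ≡⟨ ≡.cong₂ _+_ (≡.trans (ℕSum.sumWhere-congᴾ inside inside⁻¹) count-inTree)
                         (ℕSum.sumWhere-congᴾ (λ H q → ∧-intro (∧-snd {R H} q) (∧-fst q)) (λ H q → ∧-intro (∧-snd {not (S H)} q) (∧-fst q))) ⟩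
        (treeVertexCount + (treeEdgeCount + treeEdgeCount)) + outsideAtTree
          ≡⟨ NP.+-comm _ outsideAtTree ⟩
        outsideAtTree + (treeVertexCount + (treeEdgeCount + treeEdgeCount)) ∎
        where
        open ≡.≡-Reasoning
        R : F G₁ → Bool
        R H = InTree i (r₁ H)
        only-tree-roots : ∀ V → T (TreeVertex i V) → count (λ H → r₁ H == V) ≡ count (λ H → R H ∧ (r₁ H == V))
        only-tree-roots V q = ℕSum.sumWhere-congᴾ
          (λ H rH=V → ∧-intro (≡.subst (T ∘ InTree i) (≡.sym (==⇒≡ rH=V)) (treeVertex-inTree q)) rH=V) (λ H → ∧-snd {R H})
        inside : ∀ H → T (R H ∧ S H) → T (InTree i H)
        inside H q = inTree-at-root (∧-snd {R H} q) (∧-fst q)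
        inside⁻¹ : ∀ H → T (InTree i H) → T (R H ∧ S H)
        inside⁻¹ H q = ∧-intro (inTree-root q) (inTree-S q)

      sum-val-tree : treeEdgeCount + 1 ≡ treeVertexCount →
                     sumℤ (TreeVertex i) (λ V → val G₁ V ℤ.- + 2) ≡ + outsideAtTree ℤ.- + 2
      sum-val-tree isTree = begin
        sumℤ (TreeVertex i) (λ V → val G₁ V ℤ.- + 2)
          ≡⟨ ℤSum.sumWhere-congᶠ (λ V _ → regroup (+ rootedAt V)) ⟩
        sumℤ (TreeVertex i) (λ V → + rootedAt V ℤ.- + 3)
          ≡⟨ sumℤ-sub (TreeVertex i) (λ V → + rootedAt V) (λ _ → + 3) ⟩
        sumℤ (TreeVertex i) (λ V → + rootedAt V) ℤ.- sumℤ (TreeVertex i) (λ _ → + 3)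
          ≡⟨ ≡.cong₂ ℤ._-_ (≡.trans (sumℤ-pos (TreeVertex i) rootedAt) (≡.cong +_ sum-rootedAt))
                           (≡.trans (sumℤ-pos (TreeVertex i) (λ _ → 3)) (≡.cong +_ (sumℕ-const (TreeVertex i) 3))) ⟩
        + (outsideAtTree + (treeVertexCount + (treeEdgeCount + treeEdgeCount))) ℤ.- + (3 * treeVertexCount)
          ≡⟨ pos-diff-cong {b = outsideAtTree} {d = 3 * treeVertexCount} counts ⟩
        + outsideAtTree ℤ.- + 2 ∎
        where
        open ≡.≡-Reasoning
        rootedAt : F G₁ → ℕ
        rootedAt V = count (λ H → r₁ H == V)
        regroup : ∀ c → c ℤ.- + 1 ℤ.- + 2 ≡ c ℤ.- + 3
        regroup = solve-∀
        arith : ∀ N E → N + ((E + 1) + (E + E)) + 2 ≡ N + 3 * (E + 1)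
        arith = ℕSolver.solve-∀
        counts : outsideAtTree + (treeVertexCount + (treeEdgeCount + treeEdgeCount)) + 2 ≡ outsideAtTree + 3 * treeVertexCount
        counts = ≡.subst (λ V → outsideAtTree + (V + (treeEdgeCount + treeEdgeCount)) + 2 ≡ outsideAtTree + 3 * V)
                         isTree (arith outsideAtTree treeEdgeCount)

      degree-val-over : ∀ {z} → OverE z →
        sumℤ (λ V → TreeVertex i V ∧ (π V == r₂ z)) (λ V → + d V ℤ.* (val G₂ (π V) ℤ.- + 2))
        ≡ + treeDegree i ℤ.* (val G₂ (r₂ z) ℤ.- + 2)
      degree-val-over {z} z-overE = begin
        sumℤ Over (λ V → + d V ℤ.* k (π V))
          ≡⟨ ℤSum.sumWhere-congᶠ (λ V q → ≡.cong (λ a → + d V ℤ.* k a) (==⇒≡ (∧-snd {TreeVertex i V} q))) ⟩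
        sumℤ Over (λ V → + d V ℤ.* k (r₂ z))
          ≡⟨ sumℤ-*ʳ Over (λ V → + d V) (k (r₂ z)) ⟩
        sumℤ Over (λ V → + d V) ℤ.* k (r₂ z)
          ≡⟨ ≡.cong (ℤ._* k (r₂ z)) (≡.trans (sumℤ-pos Over d) (≡.cong +_ (treeVertices-over-degree z-overE i))) ⟩
        + treeDegree i ℤ.* k (r₂ z) ∎
        where
        open ≡.≡-Reasoning
        Over : F G₁ → Bool
        Over V = TreeVertex i V ∧ (π V == r₂ z)
        k : F G₂ → ℤ
        k a = val G₂ a ℤ.- + 2

      sum-degree-val-edge : ¬ A ≡ B →
        sumℤ (TreeVertex i) (λ V → + d V ℤ.* (val G₂ (π V) ℤ.- + 2)) ≡ + treeDegree i ℤ.* (+ outsideAtAB ℤ.- + 2)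
      sum-degree-val-edge A≢B = begin
        sumℤ (TreeVertex i) f
          ≡⟨ ℤSum.sumWhere-split (TreeVertex i) (λ V → π V == A) f ⟩
        sumℤ (λ V → TreeVertex i V ∧ (π V == A)) f ℤ.+ sumℤ (λ V → TreeVertex i V ∧ not (π V == A)) f
          ≡⟨ ≡.cong (λ s → sumℤ (λ V → TreeVertex i V ∧ (π V == A)) f ℤ.+ s) (ℤSum.sumWhere-congᴾ {f = f} not-A⇒B B⇒not-A) ⟩
        sumℤ (λ V → TreeVertex i V ∧ (π V == A)) f ℤ.+ sumℤ (λ V → TreeVertex i V ∧ (π V == B)) f
          ≡⟨ ≡.cong₂ ℤ._+_ (degree-val-over (inj₁ ≡.refl)) (degree-val-over (inj₂ ≡.refl)) ⟩
        + treeDegree i ℤ.* k A ℤ.+ + treeDegree i ℤ.* k B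
          ≡⟨ ZP.*-distribˡ-+ (+ treeDegree i) (k A) (k B) ⟨
        + treeDegree i ℤ.* (k A ℤ.+ k B)
          ≡⟨ ≡.cong (λ k → + treeDegree i ℤ.* k) (val-A+val-B A≢B) ⟩
        + treeDegree i ℤ.* (+ outsideAtAB ℤ.- + 2) ∎
        where
        open ≡.≡-Reasoning
        k : F G₂ → ℤ
        k a = val G₂ a ℤ.- + 2
        f : F G₁ → ℤ
        f V = + d V ℤ.* k (π V)
        not-A⇒B : ∀ V → T (TreeVertex i V ∧ not (π V == A)) → T (TreeVertex i V ∧ (π V == B))
        not-A⇒B V q with treeVertex-over-AB (∧-fst q)
        ... | inj₁ πV≡A = ⊥-elim (not-elim (∧-snd {TreeVertex i V} q) (≡⇒== πV≡A))
        ... | inj₂ πV≡B = ∧-intro (∧-fst q) (≡⇒== πV≡B)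
        B⇒not-A : ∀ V → T (TreeVertex i V ∧ (π V == B)) → T (TreeVertex i V ∧ not (π V == A))
        B⇒not-A V q = ∧-intro (∧-fst q) (not-intro (λ πV=A → A≢B (≡.trans (≡.sym (==⇒≡ πV=A)) (==⇒≡ (∧-snd {TreeVertex i V} q)))))

      sum-degree-val-loop : A ≡ B → treeDegree i ≡ 0 →
        sumℤ (TreeVertex i) (λ V → + d V ℤ.* (val G₂ (π V) ℤ.- + 2)) ≡ + treeDegree i ℤ.* (+ outsideAtAB ℤ.- + 2)
      sum-degree-val-loop A≡B degree≡0 = begin
        sumℤ (TreeVertex i) f
          ≡⟨ ℤSum.sumWhere-congᴾ {f = f} (λ V q → ∧-intro q (≡⇒== (treeVertex-over-loop A≡B q))) (λ V → ∧-fst) ⟩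
        sumℤ (λ V → TreeVertex i V ∧ (π V == A)) f
          ≡⟨ degree-val-over (inj₁ ≡.refl) ⟩
        + treeDegree i ℤ.* (val G₂ A ℤ.- + 2)
          ≡⟨ ≡.cong (λ D → + D ℤ.* (val G₂ A ℤ.- + 2)) degree≡0 ⟩
        + 0
          ≡⟨ ≡.cong (λ D → + D ℤ.* (+ outsideAtAB ℤ.- + 2)) degree≡0 ⟨
        + treeDegree i ℤ.* (+ outsideAtAB ℤ.- + 2) ∎
        where
        open ≡.≡-Reasoning
        f : F G₁ → ℤ
        f V = + d V ℤ.* (val G₂ (π V) ℤ.- + 2)

      harmonic-over-tree : ∀ {z} → ¬ IsVertex G₂ z → r₂ z ≡ A ⊎ r₂ z ≡ B →
                           sumℕ (λ x → (π x == z) ∧ InTree i (r₁ x)) d ≡ treeDegree i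
      harmonic-over-tree {z} z-half rz-endpoint = begin
        sumℕ RootInTree d
          ≡⟨ ℕSum.sumWhere-fibres RootInTree d r₁ (TreeVertex i) (λ x q → treeVertex-intro (G₁.root-isVertex x) (∧-snd {π x == z} q)) ⟩
        sumℕ (TreeVertex i) (λ V → sumℕ (λ x → RootInTree x ∧ (r₁ x == V)) d)
          ≡⟨ ℕSum.sumWhere-congᶠ restrict-fibre ⟩
        sumℕ (TreeVertex i) fibreSum
          ≡⟨ ℕSum.sumWhere-split (TreeVertex i) (λ V → π V == r₂ z) fibreSum ⟩
        sumℕ (λ V → TreeVertex i V ∧ (π V == r₂ z)) fibreSum + sumℕ (λ V → TreeVertex i V ∧ not (π V == r₂ z)) fibreSum
          ≡⟨ ≡.cong₂ _+_ (ℕSum.sumWhere-congᶠ (λ V q → harmonic-fibre (treeVertex-vertex (∧-fst q)) z-half (≡.sym (==⇒≡ (∧-snd {TreeVertex i V} q)))))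
                         (ℕSum.sumWhere-zero (λ V q → empty-fibre (not-elim (∧-snd {TreeVertex i V} q) ∘ ≡⇒== ∘ ≡.sym))) ⟩
        sumℕ (λ V → TreeVertex i V ∧ (π V == r₂ z)) d + 0
          ≡⟨ NP.+-identityʳ _ ⟩
        sumℕ (λ V → TreeVertex i V ∧ (π V == r₂ z)) d
          ≡⟨ over-endpoint rz-endpoint ⟩
        treeDegree i ∎
        where
        open ≡.≡-Reasoning
        RootInTree : F G₁ → Bool
        RootInTree x = (π x == z) ∧ InTree i (r₁ x)
        fibreSum : F G₁ → ℕ
        fibreSum V = sumℕ (FibreAt z V) d
        restrict-fibre : ∀ V → T (TreeVertex i V) → sumℕ (λ x → RootInTree x ∧ (r₁ x == V)) d ≡ fibreSum V
        restrict-fibre V V-tree = ℕSum.sumWhere-congᴾ forget remember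
          where
          forget : ∀ x → T (RootInTree x ∧ (r₁ x == V)) → T (FibreAt z V x)
          forget x q = ∧-intro (∧-fst (∧-fst q)) (∧-snd {RootInTree x} q)
          remember : ∀ x → T (FibreAt z V x) → T (RootInTree x ∧ (r₁ x == V))
          remember x q = ∧-intro (∧-intro (∧-fst {π x == z} q) rx-tree) (∧-snd {π x == z} q)
            where
            rx-tree : T (InTree i (r₁ x))
            rx-tree = ≡.subst (T ∘ InTree i) (≡.sym (==⇒≡ (∧-snd {π x == z} q))) (treeVertex-inTree V-tree)
        over-cong : ∀ {a b} → a ≡ b → sumℕ (λ V → TreeVertex i V ∧ (π V == a)) d ≡ sumℕ (λ V → TreeVertex i V ∧ (π V == b)) d
        over-cong a≡b = ℕSum.sumWhere-cong (λ V → ≡.cong (λ a → TreeVertex i V ∧ (π V == a)) a≡b) (λ _ _ → ≡.refl)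
        over-endpoint : r₂ z ≡ A ⊎ r₂ z ≡ B → sumℕ (λ V → TreeVertex i V ∧ (π V == r₂ z)) d ≡ treeDegree i
        over-endpoint (inj₁ rz≡A) = ≡.trans (over-cong rz≡A) (treeVertices-over-degree (inj₁ ≡.refl) i)
        over-endpoint (inj₂ rz≡B) = ≡.trans (over-cong rz≡B) (treeVertices-over-degree (inj₂ ≡.refl) i)

      Leaving : (F G₁ → Bool) → F G₁ → Bool
      Leaving W h = TreeEdge i h ∧ not (W (r₁ h) ∧ W (r₁ (ι₁ h)))

      private
        _+ᵛ_ : (F G₁ → Bool) → F G₁ → F G₁ → Bool
        (W +ᵛ u) V = W V ∨ (V == u)

        CrossingHalf : (F G₁ → Bool) → F G₁ → Set
        CrossingHalf W h = T (S h) × T (W (r₁ h)) × ¬ T (W (r₁ (ι₁ h)))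

        crossing-step : ∀ W {x y} → AdjIn G₁ S x y → T (W (r₁ x)) → ¬ T (W (r₁ y)) → ∃ (CrossingHalf W)
        crossing-step W {x} {y} (_ , _ , inj₁ y≡rx) Wrx ¬Wry =
          ⊥-elim (¬Wry (≡.subst (T ∘ W) (≡.trans (≡.sym (G₁.root-isVertex x)) (≡.cong r₁ (≡.sym y≡rx))) Wrx))
        crossing-step W {x} {y} (sx , _ , inj₂ (inj₁ y≡ιx)) Wrx ¬Wry =
          x , sx , Wrx , ¬Wry ∘ ≡.subst (T ∘ W ∘ r₁) (≡.sym y≡ιx)
        crossing-step W {x} {y} (_ , _ , inj₂ (inj₂ (inj₁ x≡ry))) Wrx ¬Wry =
          ⊥-elim (¬Wry (≡.subst (T ∘ W) (≡.trans (≡.cong r₁ x≡ry) (G₁.root-isVertex y)) Wrx))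
        crossing-step W {x} {y} (_ , sy , inj₂ (inj₂ (inj₂ x≡ιy))) Wrx ¬Wry =
          ι₁ y , S-ι sy , ≡.subst (T ∘ W ∘ r₁) x≡ιy Wrx , ¬Wry ∘ ≡.subst (T ∘ W ∘ r₁) (G₁.ι-invol y)

        crossing-half : ∀ W {w u} → T (TreeVertex i w) → T (W w) → T (TreeVertex i u) → ¬ T (W u) → ∃ (CrossingHalf W)
        crossing-half W {w} {u} w-tree Ww u-tree ¬Wu with Star-crossing (W ∘ r₁) w~u Wrw ¬Wru
          where
          w~u : SameComp G₁ S w u
          w~u = Equivalence.to (comp-spec w u (inTree-S (treeVertex-inTree w-tree)) (inTree-S (treeVertex-inTree u-tree)))
                               (≡.trans (inTree-comp (treeVertex-inTree w-tree)) (≡.sym (inTree-comp (treeVertex-inTree u-tree))))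
          Wrw : T (W (r₁ w))
          Wrw = ≡.subst (T ∘ W) (≡.sym (treeVertex-vertex w-tree)) Ww
          ¬Wru : ¬ T (W (r₁ u))
          ¬Wru = ¬Wu ∘ ≡.subst (T ∘ W) (treeVertex-vertex u-tree)
        ... | x , y , x~y , Wrx , ¬Wry = crossing-step W x~y Wrx ¬Wry

        crossing-edge : ∀ W {h} → (∀ V → T (W V) → T (TreeVertex i V)) → CrossingHalf W h →
          ∃ λ a → T (Leaving W a) × ¬ T (Leaving (W +ᵛ r₁ (ι₁ h)) a)
        crossing-edge W {h} W⊆tree (sh , Wrh , ¬Wrιh) with G₁.edgeRep-either h-half (S-half-≢ι sh h-half)
          where
          h-half : ¬ IsVertex G₁ h
          h-half h-vertex = ¬Wrιh (≡.subst (T ∘ W ∘ r₁) (≡.sym (G₁.ι-vertex h-vertex)) Wrh)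
        ... | inj₁ rep   = h , ∧-intro (∧-intro rep h-tree) (not-intro (¬Wrιh ∘ ∧-snd {W (r₁ h)})) ,
                               λ q → not-elim (∧-snd {TreeEdge i h} q) (∧-intro (∨-inl Wrh) (∨-inr {W (r₁ (ι₁ h))} (==-refl _)))
          where
          h-tree : T (InTree i h)
          h-tree = inTree-at-root sh (treeVertex-inTree (W⊆tree _ Wrh))
        ... | inj₂ rep-ι = ι₁ h , ∧-intro (∧-intro rep-ι (inTree-ι h-tree)) (not-intro (¬Wrιh ∘ ∧-fst)) ,
                               λ q → not-elim (∧-snd {TreeEdge i (ι₁ h)} q)
                                 (∧-intro (∨-inr {W (r₁ (ι₁ h))} (==-refl _)) (≡.subst (T ∘ (W +ᵛ r₁ (ι₁ h)) ∘ r₁) (≡.sym (G₁.ι-invol h)) (∨-inl Wrh)))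
          where
          h-tree : T (InTree i h)
          h-tree = inTree-at-root sh (treeVertex-inTree (W⊆tree _ Wrh))

        outside-extend : ∀ W {u} → T (TreeVertex i u) → ¬ T (W u) →
          count (λ V → TreeVertex i V ∧ not (W V)) ≡ suc (count (λ V → TreeVertex i V ∧ not ((W +ᵛ u) V)))
        outside-extend W {u} u-tree ¬Wu =
          ≡.trans (sumℕ-split-at (λ _ → 1) u (∧-intro u-tree (not-intro ¬Wu))) (≡.cong suc (ℕSum.sumWhere-congᴾ to from))
          where
          to : ∀ V → T ((TreeVertex i V ∧ not (W V)) ∧ not (V == u)) → T (TreeVertex i V ∧ not ((W +ᵛ u) V))
          to V q = ∧-intro (∧-fst (∧-fst q)) (not-intro ([ ¬W , ¬u ]′ ∘ ∨-case {W V}))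
            where
            ¬W : ¬ T (W V)
            ¬W = not-elim (∧-snd {TreeVertex i V} (∧-fst q))
            ¬u : ¬ T (V == u)
            ¬u = not-elim (∧-snd {TreeVertex i V ∧ not (W V)} q)
          from : ∀ V → T (TreeVertex i V ∧ not ((W +ᵛ u) V)) → T ((TreeVertex i V ∧ not (W V)) ∧ not (V == u))
          from V q = ∧-intro (∧-intro (∧-fst q) (not-intro (not-elim (∧-snd {TreeVertex i V} q) ∘ ∨-inl {W V} {V == u})))
                             (not-intro (not-elim (∧-snd {TreeVertex i V} q) ∘ ∨-inr {W V}))

        leaving-extend : ∀ W u x → T (Leaving (W +ᵛ u) x) → T (Leaving W x)
        leaving-extend W u x q = ∧-intro (∧-fst q) (not-intro (λ both → not-elim (∧-snd {TreeEdge i x} q)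
          (∧-intro (∨-inl {W (r₁ x)} {r₁ x == u} (∧-fst both)) (∨-inl {W (r₁ (ι₁ x))} {r₁ (ι₁ x) == u} (∧-snd {W (r₁ x)} both)))))

      -- Induction on the vertices outside W: connectedness gives an edge leaving W, and adding its
      -- far end to W makes that edge stop leaving.
      spanning-bound : ∀ n W → (∀ V → T (W V) → T (TreeVertex i V)) → ∃ (T ∘ W) →
        count (λ V → TreeVertex i V ∧ not (W V)) ≡ n → n ≤ count (Leaving W)
      spanning-bound zero    _ _ _ _ = z≤n
      spanning-bound (suc n) W W⊆tree (w , Ww) count≡ with sumℕ≢0⇒∃ (λ V → TreeVertex i V ∧ not (W V)) (λ _ → 1) some-outside
        where
        some-outside : ¬ count (λ V → TreeVertex i V ∧ not (W V)) ≡ 0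
        some-outside c≡0 = NP.0≢1+n (≡.trans (≡.sym c≡0) count≡)
      ... | u , u-outside , _ with crossing-half W (W⊆tree w Ww) Ww (∧-fst u-outside) (not-elim (∧-snd {TreeVertex i u} u-outside))
      ...   | h , crossing@(sh , Wrh , ¬Wrιh) with crossing-edge W W⊆tree crossing
      ...     | a , a-leaving , a-not-leaving =
        NP.≤-trans (s≤s IH) (count-strict-mono a (leaving-extend W u′) a-leaving a-not-leaving)
        where
        u′ : F G₁
        u′ = r₁ (ι₁ h)
        u′-tree : T (TreeVertex i u′)
        u′-tree = treeVertex-intro (G₁.root-isVertex (ι₁ h)) (inTree-root (inTree-ι (inTree-at-root sh (treeVertex-inTree (W⊆tree _ Wrh)))))
        W′⊆tree : ∀ V → T ((W +ᵛ u′) V) → T (TreeVertex i V)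
        W′⊆tree V q with ∨-case {W V} q
        ... | inj₁ WV   = W⊆tree V WV
        ... | inj₂ V=u′ = ≡.subst (T ∘ TreeVertex i) (≡.sym (==⇒≡ V=u′)) u′-tree
        IH : n ≤ count (Leaving (W +ᵛ u′))
        IH = spanning-bound n (W +ᵛ u′) W′⊆tree (w , ∨-inl Ww)
               (NP.suc-injective (≡.trans (≡.sym (outside-extend W u′-tree ¬Wrιh)) count≡))

      module _ (A≡B : A ≡ B) where

        private
          Positive : ℕ → Bool
          Positive k = 0 ℕ.<ᵇ k

          positive-intro : ∀ {k} → ¬ k ≡ 0 → T (Positive k)
          positive-intro k≢0 = NP.<⇒<ᵇ (NP.n≢0⇒n>0 k≢0)

          positive-elim : ∀ {k} → T (Positive k) → ¬ k ≡ 0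
          positive-elim {k} q = NP.n>0⇒n≢0 (NP.<ᵇ⇒< 0 k q)

          PosVertex PosHalf PosEdge : F G₁ → Bool
          PosVertex V = TreeVertex i V ∧ Positive (d V)
          PosHalf x = (InTree i x ∧ not (isV G₁ x)) ∧ Positive (d x)
          PosEdge h = TreeEdge i h ∧ Positive (d h)

          positive-half : ∀ {V z} → T (PosVertex V) → OverE z → r₂ z ≡ π V → ∃ λ x → T (PosHalf x ∧ (r₁ x == V)) × π x ≡ z
          positive-half {V} {z} V-pos z-overE rz≡πV =
            let (x , x-fibre , dx≢0) = sumℕ≢0⇒∃ (FibreAt z V) d fibre≢0
                πx≡z : π x ≡ z
                πx≡z = ==⇒≡ (∧-fst x-fibre)
                rx=V : T (r₁ x == V)
                rx=V = ∧-snd {π x == z} x-fibre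
                πx-overE : OverE (π x)
                πx-overE = ≡.subst OverE (≡.sym πx≡z) z-overE
                x-tree : T (InTree i x)
                x-tree = inTree-at-root (overE⇒S πx-overE) (≡.subst (T ∘ InTree i) (≡.sym (==⇒≡ rx=V)) (treeVertex-inTree V-tree))
            in x , ∧-intro (∧-intro (∧-intro x-tree (not-intro (overE-half πx-overE ∘ G₁.isV⇒IsVertex))) (positive-intro dx≢0)) rx=V , πx≡z
            where
            V-tree : T (TreeVertex i V)
            V-tree = ∧-fst V-pos
            fibre≢0 : ¬ sumℕ (FibreAt z V) d ≡ 0
            fibre≢0 sum≡0 = positive-elim (∧-snd {TreeVertex i V} V-pos)
              (≡.trans (≡.sym (harmonic-fibre (treeVertex-vertex V-tree) (overE-¬vertex z-overE) rz≡πV)) sum≡0)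

          -- For a loop, both e and ι e hang at π V, so V has a positive half over each of them.
          two-positive-halves : ∀ V → T (PosVertex V) → 2 ≤ count (λ x → PosHalf x ∧ (r₁ x == V))
          two-positive-halves V V-pos =
            let (x₁ , x₁-half , πx₁≡e)  = positive-half V-pos (inj₁ ≡.refl) (≡.sym πV≡A)
                (x₂ , x₂-half , πx₂≡ιe) = positive-half V-pos (inj₂ ≡.refl) (≡.trans (≡.sym A≡B) (≡.sym πV≡A))
            in count-≥2 x₁ x₂ (λ x₁≡x₂ → e-edge (≡.trans (≡.sym πx₂≡ιe) (≡.trans (≡.cong π (≡.sym x₁≡x₂)) πx₁≡e)))
                        x₁-half x₂-half
            where
            πV≡A : π V ≡ A
            πV≡A = treeVertex-over-loop A≡B (∧-fst V-pos)

          posVertices≤posEdges : count PosVertex ≤ count PosEdge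
          posVertices≤posEdges = NP.*-cancelˡ-≤ 2 (begin
            2 * count PosVertex
              ≡⟨ sumℕ-const PosVertex 2 ⟨
            sumℕ PosVertex (λ _ → 2)
              ≤⟨ sumℕ-mono-≤ PosVertex two-positive-halves ⟩
            sumℕ PosVertex halvesAt
              ≤⟨ NP.m≤m+n _ _ ⟩
            sumℕ PosVertex halvesAt + sumℕ (λ V → TreeVertex i V ∧ not (Positive (d V))) halvesAt
              ≡⟨ ℕSum.sumWhere-split (TreeVertex i) (Positive ∘ d) halvesAt ⟨
            sumℕ (TreeVertex i) halvesAt
              ≡⟨ ℕSum.sumWhere-fibres PosHalf (λ _ → 1) r₁ (TreeVertex i)
                   (λ x q → treeVertex-intro (G₁.root-isVertex x) (inTree-root (∧-fst (∧-fst q)))) ⟨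
            count PosHalf
              ≡⟨ treeHalves (Positive ∘ d) (λ h → ≡.cong Positive (deg-ι h)) ⟩
            count PosEdge + count PosEdge
              ≡⟨ ≡.cong (λ k → count PosEdge + k) (NP.+-identityʳ (count PosEdge)) ⟨
            2 * count PosEdge ∎)
            where
            open NP.≤-Reasoning
            halvesAt : F G₁ → ℕ
            halvesAt V = count (λ x → PosHalf x ∧ (r₁ x == V))

          posEdge-ends-positive : ∀ {h} → T (InTree i h) → ¬ IsVertex G₁ h → T (Positive (d h)) → T (PosVertex (r₁ h))
          posEdge-ends-positive {h} h-tree h-half dh>0 =
            ∧-intro (treeVertex-intro (G₁.root-isVertex h) (inTree-root h-tree))
                    (NP.<⇒<ᵇ (NP.<-≤-trans (NP.<ᵇ⇒< 0 (d h) dh>0) (NP.≤-trans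
                      (term≤sumℕ d h (∧-intro (==-refl (π h)) (==-refl (r₁ h))))
                      (NP.≤-reflexive (harmonic-fibre (G₁.root-isVertex h)
                        (overE-¬vertex (S-half⇒overE (inTree-S h-tree) h-half)) (≡.sym (comm-r h)))))))

          leaving-has-degree-0 : ∀ h → T (Leaving PosVertex h) → T (TreeEdge i h ∧ not (Positive (d h)))
          leaving-has-degree-0 h q = ∧-intro h-edge (not-intro (λ dh>0 → not-elim (∧-snd {TreeEdge i h} q)
            (∧-intro (posEdge-ends-positive h-tree h-half dh>0)
                     (posEdge-ends-positive (inTree-ι h-tree) (G₁.ι-¬vertex h-half) (≡.subst (T ∘ Positive) (≡.sym (deg-ι h)) dh>0)))))
            where
            h-edge : T (TreeEdge i h)
            h-edge = ∧-fst q
            h-tree : T (InTree i h)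
            h-tree = treeEdge-inTree h-edge
            h-half : ¬ IsVertex G₁ h
            h-half = G₁.edgeRep-half (∧-fst h-edge)

          zeroVertices≤zeroEdges : ∃ (T ∘ PosVertex) →
            count (λ V → TreeVertex i V ∧ not (Positive (d V))) ≤ count (λ h → TreeEdge i h ∧ not (Positive (d h)))
          zeroVertices≤zeroEdges pos = NP.≤-trans
            (spanning-bound _ PosVertex (λ V → ∧-fst) pos (ℕSum.sumWhere-congᴾ from to))
            (count-mono leaving-has-degree-0)
            where
            to : ∀ V → T (TreeVertex i V ∧ not (Positive (d V))) → T (TreeVertex i V ∧ not (PosVertex V))
            to V q = ∧-intro (∧-fst q) (not-intro (not-elim (∧-snd {TreeVertex i V} q) ∘ ∧-snd {TreeVertex i V} {Positive (d V)}))
            from : ∀ V → T (TreeVertex i V ∧ not (PosVertex V)) → T (TreeVertex i V ∧ not (Positive (d V)))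
            from V q = ∧-intro V-tree (not-intro (not-elim (∧-snd {TreeVertex i V} q) ∘ ∧-intro V-tree))
              where
              V-tree : T (TreeVertex i V)
              V-tree = ∧-fst q

        treeDegree-loop : treeEdgeCount + 1 ≡ treeVertexCount → treeDegree i ≡ 0
        treeDegree-loop isTree with treeDegree i NP.≟ 0
        ... | yes degree≡0 = degree≡0
        ... | no  degree≢0 with sumℕ≢0⇒∃ (TreeEdge i) d degree≢0
        ...   | h , h-edge , dh≢0 = ⊥-elim (NP.1+n≰n (NP.≤-trans (NP.≤-reflexive (≡.trans (NP.+-comm 1 treeEdgeCount) isTree)) V≤E))
          where
          some-positive : ∃ (T ∘ PosVertex)
          some-positive = r₁ h , posEdge-ends-positive (treeEdge-inTree h-edge) (G₁.edgeRep-half (∧-fst h-edge)) (positive-intro dh≢0)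
          V≤E : treeVertexCount ≤ treeEdgeCount
          V≤E = NP.≤-trans (NP.≤-reflexive (ℕSum.sumWhere-split (TreeVertex i) (Positive ∘ d) (λ _ → 1)))
                (NP.≤-trans (NP.+-mono-≤ posVertices≤posEdges (zeroVertices≤zeroEdges some-positive))
                (NP.≤-reflexive (≡.sym (ℕSum.sumWhere-split (TreeEdge i) (Positive ∘ d) (λ _ → 1)))))

      sum-degree-val : treeEdgeCount + 1 ≡ treeVertexCount →
        sumℤ (TreeVertex i) (λ V → + d V ℤ.* (val G₂ (π V) ℤ.- + 2)) ≡ + treeDegree i ℤ.* (+ outsideAtAB ℤ.- + 2)
      sum-degree-val isTree with A ≟ B
      ... | yes A≡B = sum-degree-val-loop A≡B (treeDegree-loop A≡B isTree)
      ... | no  A≢B = sum-degree-val-edge A≢B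

    module Contracted
      {G₁′ : Graph} {c₁ : F G₁ → F G₁′} (con₁ : IsContraction G₁ S G₁′ c₁)
      {G₂′ : Graph} {p : F G₂ → F G₂′} (con₂ : IsContraction G₂ ES G₂′ p)
      (πₑ : F G₁′ → F G₂′)
      (πₑ-outside : ∀ x → T (not (S x)) → πₑ (c₁ x) ≡ p (π x))
      (πₑ-inside : ∀ x → T (S x) → πₑ (c₁ x) ≡ p e)
      (dₑ : F G₁′ → ℕ)
      (dₑ-outside : ∀ x → T (not (S x)) → dₑ (c₁ x) ≡ d x)
      (dₑ-inside : ∀ x → T (S x) → dₑ (c₁ x) ≡ treeDegree (comp x)) where

      module C₁ = ContractionFacts con₁
      module C₂ = Collapsed con₂
      open IsContraction con₁ using () renaming (root to c₁-root; invol to c₁-invol; surj to c₁-surj)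
      open IsContraction con₂ using () renaming (root to p-root; invol to p-invol; surj to p-surj)

      c₁-tree : ∀ {x y} → T (S x) → T (S y) → comp x ≡ comp y → c₁ x ≡ c₁ y
      c₁-tree {x} {y} sx sy cx≡cy = C₁.identify sx sy (Equivalence.to (comp-spec x y sx sy) cx≡cy)

      c₁-tree⁻¹ : ∀ {x y} → T (S x) → c₁ x ≡ c₁ y → T (S y) × comp x ≡ comp y
      c₁-tree⁻¹ {x} {y} sx cx≡cy with C₁.identified cx≡cy
      ... | inj₁ ≡.refl            = sx , ≡.refl
      ... | inj₂ (_ , sy , x~y)    = sy , comp-≡ sx sy x~y

      πₑ∘c₁ : ∀ x → πₑ (c₁ x) ≡ p (π x)
      πₑ∘c₁ x with T-or-not (S x)
      ... | inj₁ sx  = ≡.trans (πₑ-inside x sx) (≡.sym (C₂.collapse (S⇒ES∘π sx)))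
      ... | inj₂ ¬sx = πₑ-outside x ¬sx

      πₑ-comm-r : ∀ H → πₑ (rt G₁′ H) ≡ rt G₂′ (πₑ H)
      πₑ-comm-r H with c₁-surj H
      ... | x , ≡.refl = begin
        πₑ (rt G₁′ (c₁ x))  ≡⟨ ≡.cong πₑ (c₁-root x) ⟨
        πₑ (c₁ (r₁ x))      ≡⟨ πₑ∘c₁ (r₁ x) ⟩
        p (π (r₁ x))        ≡⟨ ≡.cong p (comm-r x) ⟩
        p (r₂ (π x))        ≡⟨ p-root (π x) ⟩
        rt G₂′ (p (π x))    ≡⟨ ≡.cong (rt G₂′) (πₑ∘c₁ x) ⟨
        rt G₂′ (πₑ (c₁ x))  ∎
        where open ≡.≡-Reasoning

      πₑ-comm-ι : ∀ H → πₑ (iv G₁′ H) ≡ iv G₂′ (πₑ H)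
      πₑ-comm-ι H with c₁-surj H
      ... | x , ≡.refl = begin
        πₑ (iv G₁′ (c₁ x))  ≡⟨ ≡.cong πₑ (c₁-invol x) ⟨
        πₑ (c₁ (ι₁ x))      ≡⟨ πₑ∘c₁ (ι₁ x) ⟩
        p (π (ι₁ x))        ≡⟨ ≡.cong p (comm-ι x) ⟩
        p (ι₂ (π x))        ≡⟨ p-invol (π x) ⟩
        iv G₂′ (p (π x))    ≡⟨ ≡.cong (iv G₂′) (πₑ∘c₁ x) ⟨
        iv G₂′ (πₑ (c₁ x))  ∎
        where open ≡.≡-Reasoning

      πₑ-surj : ∀ y′ → ∃ λ x′ → πₑ x′ ≡ y′
      πₑ-surj y′ with p-surj y′
      ... | y , ≡.refl with surj y
      ...   | x , ≡.refl = c₁ x , πₑ∘c₁ x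

      πₑ-noncontr : ∀ x′ → IsVertex G₂′ (πₑ x′) → IsVertex G₁′ x′
      πₑ-noncontr x′ πₑx′-vertex with c₁-surj x′
      ... | x , ≡.refl with T-or-not (S x)
      ...   | inj₁ sx  = C₁.contracted-vertex sx (S-root sx) (S~root sx)
      ...   | inj₂ ¬sx with C₂.vertex-preimage (≡.subst (IsVertex G₂′) (πₑ∘c₁ x) πₑx′-vertex)
      ...     | inj₁ πx-vertex = ≡.trans (≡.sym (c₁-root x)) (≡.cong c₁ (noncontr x πx-vertex))
      ...     | inj₂ πx-overE  = ⊥-elim (not-elim ¬sx (overE⇒S πx-overE))

      dₑ-ι : ∀ x′ → dₑ (iv G₁′ x′) ≡ dₑ x′
      dₑ-ι x′ with c₁-surj x′
      ... | x , ≡.refl with T-or-not (S x)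
      ...   | inj₁ sx  = begin
        dₑ (iv G₁′ (c₁ x))          ≡⟨ ≡.cong dₑ (c₁-invol x) ⟨
        dₑ (c₁ (ι₁ x))              ≡⟨ dₑ-inside (ι₁ x) (S-ι sx) ⟩
        treeDegree (comp (ι₁ x))    ≡⟨ ≡.cong treeDegree (comp-ι sx) ⟩
        treeDegree (comp x)         ≡⟨ dₑ-inside x sx ⟨
        dₑ (c₁ x)                   ∎
        where open ≡.≡-Reasoning
      ...   | inj₂ ¬sx = begin
        dₑ (iv G₁′ (c₁ x))          ≡⟨ ≡.cong dₑ (c₁-invol x) ⟨
        dₑ (c₁ (ι₁ x))              ≡⟨ dₑ-outside (ι₁ x) (not-intro (¬S-ι (not-elim ¬sx))) ⟩
        d (ι₁ x)                    ≡⟨ deg-ι x ⟩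
        d x                         ≡⟨ dₑ-outside x ¬sx ⟨
        dₑ (c₁ x)                   ∎
        where open ≡.≡-Reasoning

      LiftedFibre : F G₂ → F G₁′ → F G₁ → Bool
      LiftedFibre z V′ x = not (S x) ∧ ((π x == z) ∧ (c₁ (r₁ x) == V′))

      fibre-lift : ∀ {V′ z} → ¬ T (ES z) → sumℕ (λ H → (πₑ H == p z) ∧ (rt G₁′ H == V′)) dₑ ≡ sumℕ (LiftedFibre z V′) d
      fibre-lift {V′} {z} ¬ESz =
        ≡.trans (C₁.sumℕ-lift FibreAbove dₑ off-S)
                (ℕSum.sumWhere-cong (λ x → T-ext (to x) (from x)) (λ x q → dₑ-outside x (∧-fst q)))
        where
        FibreAbove : F G₁′ → Bool
        FibreAbove H = (πₑ H == p z) ∧ (rt G₁′ H == V′)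
        off-S : ∀ x → T (FibreAbove (c₁ x)) → ¬ T (S x)
        off-S x q sx = ¬ESz (C₂.collapse⁻¹ (≡.trans (≡.sym (==⇒≡ (∧-fst q))) (πₑ-inside x sx)))
        to : ∀ x → T (not (S x) ∧ FibreAbove (c₁ x)) → T (LiftedFibre z V′ x)
        to x q = ∧-intro (∧-fst {not (S x)} q)
                         (∧-intro (≡⇒== (≡.sym (C₂.injective-outside ¬ESz (≡.trans (≡.sym (==⇒≡ (∧-fst q′))) (πₑ∘c₁ x)))))
                                  (≡⇒== (≡.trans (c₁-root x) (==⇒≡ (∧-snd {πₑ (c₁ x) == p z} q′)))))
          where
          q′ : T (FibreAbove (c₁ x))
          q′ = ∧-snd {not (S x)} q
        from : ∀ x → T (LiftedFibre z V′ x) → T (not (S x) ∧ FibreAbove (c₁ x))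
        from x q = ∧-intro (∧-fst {not (S x)} q) (∧-intro (≡⇒== (≡.trans (πₑ∘c₁ x) (≡.cong p (==⇒≡ (∧-fst q′)))))
                                              (≡⇒== (≡.trans (≡.sym (c₁-root x)) (==⇒≡ (∧-snd {π x == z} q′)))))
          where
          q′ : T ((π x == z) ∧ (c₁ (r₁ x) == V′))
          q′ = ∧-snd {not (S x)} q

      fibre-outside : ∀ {v z} → IsVertex G₁ v → ¬ T (S v) → ¬ IsVertex G₂ z → p (r₂ z) ≡ p (π v) →
                      sumℕ (LiftedFibre z (c₁ v)) d ≡ d v
      fibre-outside {v} {z} v-vertex ¬sv z-half prz≡pπv = ≡.trans (ℕSum.sumWhere-congᴾ to from) (by-cases (r₂ z ≟ π v))
        where
        to : ∀ x → T (LiftedFibre z (c₁ v) x) → T (FibreAt z v x)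
        to x q = ∧-intro (∧-fst (∧-snd {not (S x)} q))
                         (≡⇒== (≡.sym (C₁.injective-outside ¬sv (≡.sym (==⇒≡ (∧-snd {π x == z} (∧-snd {not (S x)} q)))))))
        from : ∀ x → T (FibreAt z v x) → T (LiftedFibre z (c₁ v) x)
        from x q = ∧-intro (not-intro (λ sx → ¬sv (≡.subst (T ∘ S) rx≡v (S-root sx))))
                           (∧-intro (∧-fst q) (≡⇒== (≡.cong c₁ rx≡v)))
          where
          rx≡v : r₁ x ≡ v
          rx≡v = ==⇒≡ (∧-snd {π x == z} q)
        endpoint-cases : π v ≡ A ⊎ π v ≡ B → ∃ λ z′ → OverE z′ × π v ≡ r₂ z′
        endpoint-cases (inj₁ πv≡A) = e , inj₁ ≡.refl , πv≡A
        endpoint-cases (inj₂ πv≡B) = ι₂ e , inj₂ ≡.refl , πv≡B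
        by-cases : Dec (r₂ z ≡ π v) → sumℕ (FibreAt z v) d ≡ d v
        by-cases (yes rz≡πv) = harmonic-fibre v-vertex z-half rz≡πv
        by-cases (no  rz≢πv) with C₂.identified prz≡pπv
        ... | inj₁ rz≡πv = ⊥-elim (rz≢πv rz≡πv)
        ... | inj₂ (_ , ES-πv , _) with endpoint-cases (ES-vertex ES-πv (π-vertex v-vertex))
        ...   | z′ , z′-overE , πv≡rz′ = ≡.trans (empty-fibre rz≢πv) (≡.sym (degree-vanishes-off-S v-vertex ¬sv z′-overE πv≡rz′))

      fibre-tree : ∀ {v z} → T (S v) → ¬ T (ES z) → ¬ IsVertex G₂ z → p (r₂ z) ≡ p e →
                   sumℕ (LiftedFibre z (c₁ v)) d ≡ treeDegree (comp v)
      fibre-tree {v} {z} sv ¬ESz z-half prz≡pe = ≡.trans (ℕSum.sumWhere-congᴾ to from)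
        (harmonic-over-tree (comp v) z-half (ES-vertex (C₂.collapse⁻¹ prz≡pe) (G₂.root-isVertex z)))
        where
        RootInTree : F G₁ → Bool
        RootInTree x = (π x == z) ∧ InTree (comp v) (r₁ x)
        to : ∀ x → T (LiftedFibre z (c₁ v) x) → T (RootInTree x)
        to x q = ∧-intro (∧-fst {π x == z} (∧-snd {not (S x)} q)) (inTree-intro (proj₁ same-tree) (≡.sym (proj₂ same-tree)))
          where
          same-tree : T (S (r₁ x)) × comp v ≡ comp (r₁ x)
          same-tree = c₁-tree⁻¹ sv (≡.sym (==⇒≡ (∧-snd {π x == z} (∧-snd {not (S x)} q))))
        from : ∀ x → T (RootInTree x) → T (LiftedFibre z (c₁ v) x)
        from x q = ∧-intro (not-intro (λ sx → ¬ESz (≡.subst (T ∘ ES) πx≡z (S⇒ES∘π sx))))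
                           (∧-intro (≡⇒== πx≡z) (≡⇒== (c₁-tree (inTree-S rx-tree) sv (inTree-comp rx-tree))))
          where
          πx≡z : π x ≡ z
          πx≡z = ==⇒≡ (∧-fst {π x == z} q)
          rx-tree : T (InTree (comp v) (r₁ x))
          rx-tree = ∧-snd {π x == z} q

      dₑ-harmonic : ∀ V → IsVertex G₁′ V → ∀ H′ → rt G₂′ H′ ≡ πₑ V → ¬ (H′ ≡ πₑ V) →
                    dₑ V ≡ sumℕ (λ H → (πₑ H == H′) ∧ (rt G₁′ H == V)) dₑ
      dₑ-harmonic V V-vertex H′ rH′≡πₑV H′≢πₑV with c₁-surj V | p-surj H′
      ... | y , ≡.refl | z , ≡.refl = ≡.sym (begin
        sumℕ (λ H → (πₑ H == p z) ∧ (rt G₁′ H == c₁ y)) dₑ  ≡⟨ fibre-lift ¬ESz ⟩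
        sumℕ (LiftedFibre z (c₁ y)) d                       ≡⟨ ≡.cong (λ V′ → sumℕ (LiftedFibre z V′) d) cv≡cy ⟨
        sumℕ (LiftedFibre z (c₁ v)) d                       ≡⟨ by-cases (T-or-not (S v)) ⟩
        dₑ (c₁ v)                                           ≡⟨ ≡.cong dₑ cv≡cy ⟩
        dₑ (c₁ y)                                           ∎)
        where
        open ≡.≡-Reasoning
        v : F G₁
        v = r₁ y
        cv≡cy : c₁ v ≡ c₁ y
        cv≡cy = ≡.trans (c₁-root y) V-vertex
        pz-half : ¬ IsVertex G₂′ (p z)
        pz-half pz-vertex = H′≢πₑV (≡.trans (≡.sym pz-vertex) rH′≡πₑV)
        ¬ESz : ¬ T (ES z)
        ¬ESz ES-z = pz-half (≡.subst (IsVertex G₂′) (≡.sym (C₂.collapse ES-z)) C₂.Vₑ-vertex)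
        z-half : ¬ IsVertex G₂ z
        z-half z-vertex = pz-half (≡.trans (≡.sym (p-root z)) (≡.cong p z-vertex))
        prz≡pπv : p (r₂ z) ≡ p (π v)
        prz≡pπv = ≡.trans (p-root z) (≡.trans rH′≡πₑV (≡.trans (≡.cong πₑ (≡.sym cv≡cy)) (πₑ∘c₁ v)))
        by-cases : T (S v) ⊎ T (not (S v)) → sumℕ (LiftedFibre z (c₁ v)) d ≡ dₑ (c₁ v)
        by-cases (inj₁ sv)  = ≡.trans (fibre-tree sv ¬ESz z-half (≡.trans prz≡pπv (C₂.collapse (S⇒ES∘π sv)))) (≡.sym (dₑ-inside v sv))
        by-cases (inj₂ ¬sv) = ≡.trans (fibre-outside (G₁.root-isVertex y) (not-elim ¬sv) z-half prz≡pπv) (≡.sym (dₑ-outside v ¬sv))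

      πₑ-harmonic : IsHarmonic G₁′ G₂′ πₑ dₑ
      πₑ-harmonic = record
        { comm-r   = πₑ-comm-r
        ; comm-ι   = πₑ-comm-ι
        ; surj     = πₑ-surj
        ; noncontr = πₑ-noncontr
        ; deg-ι    = dₑ-ι
        ; harmonic = dₑ-harmonic
        }

      rootedAt-Vₜ : ∀ {v} → IsVertex G₁ v → T (S v) → count (λ H → rt G₁′ H == c₁ v) ≡ suc (outsideAtTree (comp v))
      rootedAt-Vₜ {v} v-vertex sv = ≡.trans (sumℕ-split-at (λ _ → 1) (c₁ v) (≡⇒== cv-vertex))
        (≡.cong suc (≡.trans (C₁.sumℕ-lift _ (λ _ → 1) off-S) (ℕSum.sumWhere-congᴾ to from)))
        where
        i : Fin m
        i = comp v
        cv-vertex : IsVertex G₁′ (c₁ v)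
        cv-vertex = ≡.trans (≡.sym (c₁-root v)) (≡.cong c₁ v-vertex)
        Other : F G₁′ → Bool
        Other H = (rt G₁′ H == c₁ v) ∧ not (H == c₁ v)
        off-S : ∀ y → T (Other (c₁ y)) → ¬ T (S y)
        off-S y q sy = not-elim (∧-snd {rt G₁′ (c₁ y) == c₁ v} q)
          (≡⇒== (≡.trans (c₁-tree sy (S-root sy) (≡.sym (comp-root sy))) (≡.trans (c₁-root y) (==⇒≡ (∧-fst q)))))
        to : ∀ y → T (not (S y) ∧ Other (c₁ y)) → T (not (S y) ∧ InTree i (r₁ y))
        to y q = ∧-intro (∧-fst {not (S y)} q) (inTree-intro (proj₁ same-tree) (≡.sym (proj₂ same-tree)))
          where
          same-tree : T (S (r₁ y)) × comp v ≡ comp (r₁ y)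
          same-tree = c₁-tree⁻¹ sv (≡.sym (≡.trans (c₁-root y) (==⇒≡ (∧-fst (∧-snd {not (S y)} q)))))
        from : ∀ y → T (not (S y) ∧ InTree i (r₁ y)) → T (not (S y) ∧ Other (c₁ y))
        from y q = ∧-intro ¬sy (∧-intro (≡⇒== (≡.trans (≡.sym (c₁-root y)) (c₁-tree (inTree-S ry-tree) sv (inTree-comp ry-tree))))
                                        (not-intro (λ cy=cv → not-elim ¬sy (≡.subst (T ∘ S) (≡.sym (C₁.injective-outside (not-elim ¬sy) (==⇒≡ cy=cv))) sv))))
          where
          ¬sy : T (not (S y))
          ¬sy = ∧-fst {not (S y)} q
          ry-tree : T (InTree i (r₁ y))
          ry-tree = ∧-snd {not (S y)} q

      val-Vₜ : ∀ {x} → T (S x) → val G₁′ (c₁ x) ≡ + outsideAtTree (comp x)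
      val-Vₜ {x} sx = ≡.cong (λ c → + c ℤ.- + 1) (begin
        count (λ H → rt G₁′ H == c₁ x)            ≡⟨ ≡.cong (λ V → count (λ H → rt G₁′ H == V)) (c₁-tree sx (S-root sx) (≡.sym (comp-root sx))) ⟩
        count (λ H → rt G₁′ H == c₁ (r₁ x))       ≡⟨ rootedAt-Vₜ (G₁.root-isVertex x) (S-root sx) ⟩
        suc (outsideAtTree (comp (r₁ x)))         ≡⟨ ≡.cong (suc ∘ outsideAtTree) (comp-root sx) ⟩
        suc (outsideAtTree (comp x))              ∎)
        where open ≡.≡-Reasoning

      riemann-hurwitz : (∀ i → treeEdgeCount i + 1 ≡ treeVertexCount i) → ∀ x → T (S x) →
                        RH G₁′ G₂′ πₑ dₑ (c₁ x) ≡ sumℤ (TreeVertex (comp x)) (RH G₁ G₂ π d)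
      riemann-hurwitz forest x sx = begin
        RH G₁′ G₂′ πₑ dₑ (c₁ x)
          ≡⟨ ≡.cong₂ (λ a b → a ℤ.- + 2 ℤ.- + dₑ (c₁ x) ℤ.* (b ℤ.- + 2)) (val-Vₜ sx) (≡.cong (val G₂′) (πₑ-inside x sx)) ⟩
        + outsideAtTree i ℤ.- + 2 ℤ.- + dₑ (c₁ x) ℤ.* (val G₂′ (p e) ℤ.- + 2)
          ≡⟨ ≡.cong₂ (λ D b → + outsideAtTree i ℤ.- + 2 ℤ.- + D ℤ.* (b ℤ.- + 2)) (dₑ-inside x sx) C₂.val-Vₑ ⟩
        + outsideAtTree i ℤ.- + 2 ℤ.- + treeDegree i ℤ.* (+ outsideAtAB ℤ.- + 2)
          ≡⟨ ≡.cong₂ ℤ._-_ (sum-val-tree i (forest i)) (sum-degree-val i (forest i)) ⟨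
        sumℤ (TreeVertex i) (λ V → val G₁ V ℤ.- + 2) ℤ.- sumℤ (TreeVertex i) (λ V → + d V ℤ.* (val G₂ (π V) ℤ.- + 2))
          ≡⟨ sumℤ-sub (TreeVertex i) (λ V → val G₁ V ℤ.- + 2) (λ V → + d V ℤ.* (val G₂ (π V) ℤ.- + 2)) ⟨
        sumℤ (TreeVertex i) (RH G₁ G₂ π d) ∎
        where
        open ≡.≡-Reasoning
        i : Fin m
        i = comp x

proposition3p1p8 :
  (G₁ G₂ : Graph) → Connected G₁ → Connected G₂ →
  (π : F G₁ → F G₂) (d : F G₁ → ℕ) → IsHarmonic G₁ G₂ π d →
  (e : F G₂) → ¬ IsVertex G₂ e → ¬ (iv G₂ e ≡ e) →
  let S = preimS G₁ G₂ π e in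
  (m : ℕ) (comp : F G₁ → Fin m) →
  (∀ x y → T (S x) → T (S y) → ((comp x ≡ comp y) ⇔ SameComp G₁ S x y)) →
  (∀ i → ∃ λ x → T (S x) × comp x ≡ i) →
  (∀ i → numEdgesIn G₁ (λ x → S x ∧ (comp x == i)) + 1
           ≡ numVertsIn G₁ (λ x → S x ∧ (comp x == i))) →
  (G₁' : Graph) (c₁ : F G₁ → F G₁') → IsContraction G₁ S G₁' c₁ →
  (G₂' : Graph) (p : F G₂ → F G₂') → IsContraction G₂ (edgeS G₂ e) G₂' p →
  (πₑ : F G₁' → F G₂') →
  (∀ x → T (not (S x)) → πₑ (c₁ x) ≡ p (π x)) →
  (∀ x → T (S x) → πₑ (c₁ x) ≡ p e) →
  (dₑ : F G₁' → ℕ) →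
  (∀ x → T (not (S x)) → dₑ (c₁ x) ≡ d x) →
  (∀ x → T (S x) →
     dₑ (c₁ x) ≡ sumℕ (λ h → isEdgeRep G₁ h ∧ S h ∧ (comp h == comp x)) d) →
  IsHarmonic G₁' G₂' πₑ dₑ ×
  (∀ x → T (S x) →
     RH G₁' G₂' πₑ dₑ (c₁ x)
       ≡ sumℤ (λ V → isV G₁ V ∧ S V ∧ (comp V == comp x)) (RH G₁ G₂ π d))
proposition3p1p8 G₁ G₂ _ _ π d harm e e-half e-edge m comp comp-spec _ forest
                 G₁′ c₁ con₁ G₂′ p con₂ πₑ πₑ-outside πₑ-inside dₑ dₑ-outside dₑ-inside =
  πₑ-harmonic , riemann-hurwitz forest
  where
  open Preimage G₁ G₂ π d harm e e-half e-edge
  open Forest m comp comp-spec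
  open Contracted con₁ con₂ πₑ πₑ-outside πₑ-inside dₑ dₑ-outside dₑ-inside
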